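{- Let $p$ be an odd prime and let $x$ be an integer not divisible by $p$. For $n\ge 0$ define $$D_n(x)=\sum_{k=0}^{n}\binom{n}{k}\binom{n+k}{k}x^k,\qquad S_n(x)=\sum_{k=0}^{n}\binom{n}{k}\binom{n+k}{k}\frac{x^k}{k+1}.$$ Then $$\sum_{k=1}^{p-1}D_k(x)S_k(x)\equiv 0 \pmod{p}.$$
   Context: For rational numbers $a,b$ and a prime power $p^r$, $a\equiv b\pmod{p^r}$ means that $a-b=p^r c$ for some rational $c$ whose denominator is not divisible by $p$. -}

module Defs where

open import Data.Nat as ℕ using (ℕ; zero; suc; _^_)
open import Data.Nat.Combinatorics using (_C_)
open import Data.Nat.Divisibility using (_∣_)
open import Data.Integer as ℤ using (ℤ; +_)
open import Data.Rational as ℚ using (ℚ; ↧ₙ_; _/_)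
open import Data.Product using (∃-syntax; _×_)
open import Relation.Nullary using (¬_)
open import Relation.Binary.PropositionalEquality using (_≡_)

ℤ→ℚ : ℤ → ℚ
ℤ→ℚ z = z / 1

Σ0to : ℕ → (ℕ → ℚ) → ℚ
Σ0to zero    f = f 0
Σ0to (suc n) f = Σ0to n f ℚ.+ f (suc n)

Σ1to : ℕ → (ℕ → ℚ) → ℚ
Σ1to zero    f = ℚ.0ℚ
Σ1to (suc n) f = Σ1to n f ℚ.+ f (suc n)

term : ℤ → ℕ → ℕ → ℤ
term x n k = (+ ((n C k) ℕ.* ((n ℕ.+ k) C k))) ℤ.* (x ℤ.^ k)

D : ℕ → ℤ → ℚ
D n x = Σ0to n (λ k → ℤ→ℚ (term x n k))

S : ℕ → ℤ → ℚ
S n x = Σ0to n (λ k → ℤ→ℚ (term x n k) ℚ.* ((+ 1) / suc k))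

_≡_[mod_^_] : ℚ → ℚ → ℕ → ℕ → Set
a ≡ b [mod p ^ r ] = ∃[ c ] ((a ℚ.- b ≡ ℤ→ℚ (+ (p ^ r)) ℚ.* c) × ¬ (p ∣ ↧ₙ c))

{-# OPTIONS --safe #-}

-- With B a k = C(k+a,2a) one has C(k,a) C(k+a,a) = C(2a,a) B a k, so for k < p
--   D_k = Σ_{a<p} C(2a,a) x^a B a k   and   S_k = Σ_{b<p} Cat_b x^b B b k,
-- where Cat_b = C(2b,b)/(b+1) is an integer.  Hence
--   Σ_{k<p} D_k S_k = Σ_{a,b<p} C(2a,a) Cat_b x^(a+b) Σ_{k<p} B a k B b k.
-- Modulo p = 2m+1, C(2a,a) ≡ (-4)^a C(m,a), Cat_b ≡ 2 (-4)^b C(m+1,b+1) for b < p-1,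
-- Cat_(p-1) ≡ -1, and the reflection B b k ≡ B b (p-1-k) turns the inner sum over k
-- into a convolution, equal to C(p+a+b, 2a+2b+1).  By Vandermonde the terms with
-- b < p-1 add up to 2 (-4x)^(p-1) and those with b = p-1 to -x^(p-1); by Fermat the
-- whole sum is 2 - 1 = 1, which is exactly its k = 0 term D_0 S_0.
module Submission where

open import Defs

-- Inside this module _*_ is multiplication on ℤ; the statement at the end uses ℚ's.
module _ where

  open import Data.Nat.Base as ℕ using (ℕ; zero; suc; _≤_; _<_; z≤n; s≤s; _∸_; _!)
  import Data.Nat.Properties as ℕ
  open import Data.Nat.Combinatorics using (_C_; nCk+nC[k+1]≡[n+1]C[k+1]; k>n⇒nCk≡0; nCn≡1; nC1≡n; nCk≡nC[n∸k])
  open import Data.Nat.Coprimality using (1-coprimeTo)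
  import Data.Nat.Coprimality as Coprime
  open import Data.Nat.Divisibility using (_∣_; _∣0; ∣-refl; ∣m∣n⇒∣m+n; ∣⇒≤; ∣1⇒≡1)
  open import Data.Nat.Primality using (Prime; euclidsLemma; prime⇒nonZero; prime⇒nonTrivial)
  open import Data.Nat.Tactic.RingSolver using () renaming (solve-∀ to solve-∀ℕ)
  open import Data.Integer.Base using (ℤ; +_; -[1+_]; ∣_∣; 0ℤ; 1ℤ; -1ℤ; _+_; _*_; _-_; -_; _^_)
  import Data.Integer.Properties as ℤ
  import Data.Integer.Divisibility.Signed as Signed
  open import Data.Integer.DivMod using (_%ℕ_; _/ℕ_; a≡a%ℕn+[a/ℕn]*n)
  open import Data.Integer.Tactic.RingSolver using (solve-∀)
  open import Data.Rational.Base as ℚ using (ℚ; mkℚ; _/_; 0ℚ; 1ℚ; ↧ₙ_)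
  import Data.Rational.Properties as ℚ
  open import Data.Product.Base using (_,_; _×_; ∃-syntax)
  open import Data.Sum.Base using (inj₁; inj₂; [_,_]′)
  open import Level using (0ℓ)
  open import Relation.Binary.Bundles using (Setoid)
  open import Relation.Binary.PropositionalEquality
  import Relation.Binary.Reasoning.Setoid as SetoidReasoning
  open import Relation.Nullary.Decidable using (yes; no; _×-dec_)
  open import Relation.Nullary.Negation using (¬_; contradiction)

  -- Finite sums, antidiagonal sums and convolution

  sum : ℕ → (ℕ → ℤ) → ℤ
  sum zero    f = 0ℤ
  sum (suc n) f = f 0 + sum n (λ i → f (suc i))

  sum-cong : ∀ n {f g : ℕ → ℤ} → (∀ i → i < n → f i ≡ g i) → sum n f ≡ sum n g
  sum-cong zero    eq = refl
  sum-cong (suc n) eq = cong₂ _+_ (eq 0 (s≤s z≤n)) (sum-cong n (λ i i<n → eq (suc i) (s≤s i<n)))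

  sum-zero : ∀ n (f : ℕ → ℤ) → (∀ i → i < n → f i ≡ 0ℤ) → sum n f ≡ 0ℤ
  sum-zero zero    f eq = refl
  sum-zero (suc n) f eq =
    cong₂ _+_ (eq 0 (s≤s z≤n)) (sum-zero n (λ i → f (suc i)) (λ i i<n → eq (suc i) (s≤s i<n)))

  sum-last : ∀ n (f : ℕ → ℤ) → sum (suc n) f ≡ sum n f + f n
  sum-last zero    f = trans (ℤ.+-identityʳ (f 0)) (sym (ℤ.+-identityˡ (f 0)))
  sum-last (suc n) f = trans (cong (_+_ (f 0)) (sum-last n (λ i → f (suc i))))
                             (sym (ℤ.+-assoc (f 0) _ (f (suc n))))

  sum-+ : ∀ n (f g : ℕ → ℤ) → sum n (λ i → f i + g i) ≡ sum n f + sum n g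
  sum-+ zero    f g = refl
  sum-+ (suc n) f g = trans (cong (_+_ (f 0 + g 0)) (sum-+ n (λ i → f (suc i)) (λ i → g (suc i))))
                            (+-interchange (f 0) (g 0) _ _)
    where
    +-interchange : ∀ a b c d → a + b + (c + d) ≡ a + c + (b + d)
    +-interchange = solve-∀

  sum-*ˡ : ∀ n c (f : ℕ → ℤ) → sum n (λ i → c * f i) ≡ c * sum n f
  sum-*ˡ zero    c f = sym (ℤ.*-zeroʳ c)
  sum-*ˡ (suc n) c f = trans (cong (_+_ (c * f 0)) (sum-*ˡ n c (λ i → f (suc i))))
                             (sym (ℤ.*-distribˡ-+ c (f 0) _))

  sum-*-sum : ∀ n n′ (f g : ℕ → ℤ) →
              sum n f * sum n′ g ≡ sum n (λ a → sum n′ (λ b → f a * g b))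
  sum-*-sum n n′ f g = begin
    sum n f * sum n′ g                     ≡⟨ ℤ.*-comm (sum n f) (sum n′ g) ⟩
    sum n′ g * sum n f                     ≡⟨ sum-*ˡ n (sum n′ g) f ⟨
    sum n (λ a → sum n′ g * f a)           ≡⟨ sum-cong n (λ a _ → ℤ.*-comm (sum n′ g) (f a)) ⟩
    sum n (λ a → f a * sum n′ g)           ≡⟨ sum-cong n (λ a _ → sum-*ˡ n′ (f a) g) ⟨
    sum n (λ a → sum n′ (λ b → f a * g b)) ∎
    where open ≡-Reasoning

  sum-comm : ∀ n n′ (f : ℕ → ℕ → ℤ) →
             sum n (λ i → sum n′ (f i)) ≡ sum n′ (λ j → sum n (λ i → f i j))
  sum-comm zero    n′ f = sym (sum-zero n′ (λ _ → 0ℤ) (λ _ _ → refl))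
  sum-comm (suc n) n′ f = trans (cong (_+_ (sum n′ (f 0))) (sum-comm n n′ (λ i → f (suc i))))
                                (sym (sum-+ n′ (f 0) (λ j → sum n (λ i → f (suc i) j))))

  sum-extend : ∀ {n n′} (f : ℕ → ℤ) → (∀ i → n ≤ i → f i ≡ 0ℤ) → n ≤ n′ → sum n f ≡ sum n′ f
  sum-extend {n′ = zero}   f vanish z≤n = refl
  sum-extend {n} {suc n′} f vanish n≤1+n′ with ℕ.m≤n⇒m<n∨m≡n n≤1+n′
  ... | inj₂ refl      = refl
  ... | inj₁ (s≤s n≤n′) = begin
    sum n f             ≡⟨ sum-extend f vanish n≤n′ ⟩
    sum n′ f            ≡⟨ ℤ.+-identityʳ (sum n′ f) ⟨
    sum n′ f + 0ℤ       ≡⟨ cong (_+_ (sum n′ f)) (vanish n′ n≤n′) ⟨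
    sum n′ f + f n′     ≡⟨ sum-last n′ f ⟨
    sum (suc n′) f      ∎
    where open ≡-Reasoning

  sum-bilinear : ∀ M K (u v : ℕ → ℤ) (w : ℕ → ℕ → ℤ) →
    sum K (λ k → sum M (λ a → u a * w a k) * sum M (λ b → v b * w b k))
      ≡ sum M (λ a → sum M (λ b → u a * v b * sum K (λ k → w a k * w b k)))
  sum-bilinear M K u v w = begin
    sum K (λ k → sum M (λ a → u a * w a k) * sum M (λ b → v b * w b k))
      ≡⟨ sum-cong K (λ k _ → sum-*-sum M M (λ a → u a * w a k) (λ b → v b * w b k)) ⟩
    sum K (λ k → sum M (λ a → sum M (λ b → t k a b)))
      ≡⟨ sum-comm K M (λ k a → sum M (t k a)) ⟩
    sum M (λ a → sum K (λ k → sum M (λ b → t k a b)))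
      ≡⟨ sum-cong M (λ a _ → sum-comm K M (t′ a)) ⟩
    sum M (λ a → sum M (λ b → sum K (λ k → t k a b)))
      ≡⟨ sum-cong M (λ a _ → sum-cong M (λ b _ → trans (sum-cong K (λ k _ → regroup (u a) (w a k) (v b) (w b k)))
                                                        (sum-*ˡ K (u a * v b) (λ k → w a k * w b k)))) ⟩
    sum M (λ a → sum M (λ b → u a * v b * sum K (λ k → w a k * w b k))) ∎
    where
    open ≡-Reasoning
    t : ℕ → ℕ → ℕ → ℤ
    t k a b = u a * w a k * (v b * w b k)
    t′ : ℕ → ℕ → ℕ → ℤ
    t′ a k b = t k a b
    regroup : ∀ ua wa vb wb → ua * wa * (vb * wb) ≡ ua * vb * (wa * wb)
    regroup = solve-∀

  antidiagonal : (ℕ → ℕ → ℤ) → ℕ → ℤ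
  antidiagonal g zero    = g 0 0
  antidiagonal g (suc s) = g 0 (suc s) + antidiagonal (λ a b → g (suc a) b) s

  antidiagonal-cong : ∀ s {g h : ℕ → ℕ → ℤ} → (∀ a b → g a b ≡ h a b) →
                      antidiagonal g s ≡ antidiagonal h s
  antidiagonal-cong zero    eq = eq 0 0
  antidiagonal-cong (suc s) eq = cong₂ _+_ (eq 0 (suc s)) (antidiagonal-cong s (λ a → eq (suc a)))

  antidiagonal-zero : ∀ s → antidiagonal (λ _ _ → 0ℤ) s ≡ 0ℤ
  antidiagonal-zero zero    = refl
  antidiagonal-zero (suc s) = trans (ℤ.+-identityˡ _) (antidiagonal-zero s)

  antidiagonal-+ : ∀ s (g h : ℕ → ℕ → ℤ) →
                   antidiagonal (λ a b → g a b + h a b) s ≡ antidiagonal g s + antidiagonal h s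
  antidiagonal-+ zero    g h = refl
  antidiagonal-+ (suc s) g h =
    trans (cong (_+_ (g 0 (suc s) + h 0 (suc s)))
                (antidiagonal-+ s (λ a → g (suc a)) (λ a → h (suc a))))
          (+-interchange (g 0 (suc s)) (h 0 (suc s)) _ _)
    where
    +-interchange : ∀ a b c d → a + b + (c + d) ≡ a + c + (b + d)
    +-interchange = solve-∀

  antidiagonal-*ʳ : ∀ s (g : ℕ → ℕ → ℤ) (F : ℕ → ℤ) →
                    antidiagonal (λ a b → g a b * F (a ℕ.+ b)) s ≡ antidiagonal g s * F s
  antidiagonal-*ʳ zero    g F = refl
  antidiagonal-*ʳ (suc s) g F =
    trans (cong (_+_ (g 0 (suc s) * F (suc s)))
                (antidiagonal-*ʳ s (λ a → g (suc a)) (λ t → F (suc t))))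
          (sym (ℤ.*-distribʳ-+ (F (suc s)) (g 0 (suc s)) _))

  antidiagonal-sucʳ : ∀ s (g : ℕ → ℕ → ℤ) →
                      antidiagonal g (suc s) ≡ antidiagonal (λ a b → g a (suc b)) s + g (suc s) 0
  antidiagonal-sucʳ zero    g = refl
  antidiagonal-sucʳ (suc s) g =
    trans (cong (_+_ (g 0 (suc (suc s)))) (antidiagonal-sucʳ s (λ a → g (suc a))))
          (sym (ℤ.+-assoc (g 0 (suc (suc s))) _ (g (suc (suc s)) 0)))

  antidiagonal≡sum : ∀ s (g : ℕ → ℕ → ℤ) → antidiagonal g s ≡ sum (suc s) (λ a → g a (s ∸ a))
  antidiagonal≡sum zero    g = sym (ℤ.+-identityʳ (g 0 0))
  antidiagonal≡sum (suc s) g = cong (_+_ (g 0 (suc s))) (antidiagonal≡sum s (λ a → g (suc a)))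

  antidiagonal-shiftˡ : ∀ a t (g : ℕ → ℕ → ℤ) → (∀ i j → i < a → g i j ≡ 0ℤ) →
                        antidiagonal g (a ℕ.+ t) ≡ antidiagonal (λ i → g (a ℕ.+ i)) t
  antidiagonal-shiftˡ zero    t g vanish = refl
  antidiagonal-shiftˡ (suc a) t g vanish =
    trans (cong (_+ antidiagonal (λ i → g (suc i)) (a ℕ.+ t)) (vanish 0 (suc (a ℕ.+ t)) (s≤s z≤n)))
          (trans (ℤ.+-identityˡ _)
                 (antidiagonal-shiftˡ a t (λ i → g (suc i)) (λ i j i<a → vanish (suc i) j (s≤s i<a))))

  antidiagonal-shiftʳ : ∀ b t (g : ℕ → ℕ → ℤ) → (∀ i j → j < b → g i j ≡ 0ℤ) →
                        antidiagonal g (b ℕ.+ t) ≡ antidiagonal (λ i j → g i (b ℕ.+ j)) t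
  antidiagonal-shiftʳ zero    t g vanish = refl
  antidiagonal-shiftʳ (suc b) t g vanish = begin
    antidiagonal g (suc b ℕ.+ t)
      ≡⟨ antidiagonal-sucʳ (b ℕ.+ t) g ⟩
    antidiagonal (λ i j → g i (suc j)) (b ℕ.+ t) + g (suc (b ℕ.+ t)) 0
      ≡⟨ cong₂ _+_ (antidiagonal-shiftʳ b t (λ i j → g i (suc j)) (λ i j j<b → vanish i (suc j) (s≤s j<b)))
                   (vanish (suc (b ℕ.+ t)) 0 (s≤s z≤n)) ⟩
    antidiagonal (λ i j → g i (suc b ℕ.+ j)) t + 0ℤ
      ≡⟨ ℤ.+-identityʳ _ ⟩
    antidiagonal (λ i j → g i (suc b ℕ.+ j)) t ∎
    where open ≡-Reasoning

  sum-square≡sum-antidiagonal : ∀ n (g : ℕ → ℕ → ℤ) → (∀ a b → n ≤ a ℕ.+ b → g a b ≡ 0ℤ) →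
                                sum n (λ a → sum n (g a)) ≡ sum n (antidiagonal g)
  sum-square≡sum-antidiagonal zero    g vanish = refl
  sum-square≡sum-antidiagonal (suc n) g vanish = begin
    sum (suc n) (g 0) + sum n (λ a → sum (suc n) (g (suc a)))
      ≡⟨ cong (_+_ (sum (suc n) (g 0))) (sum-cong n (λ a _ → drop-last a)) ⟩
    sum (suc n) (g 0) + sum n (λ a → sum n (g (suc a)))
      ≡⟨ cong (_+_ (sum (suc n) (g 0)))
              (sum-square≡sum-antidiagonal n (λ a → g (suc a)) (λ a b n≤a+b → vanish (suc a) b (s≤s n≤a+b))) ⟩
    g 0 0 + sum n (λ s → g 0 (suc s)) + sum n (λ s → antidiagonal (λ a → g (suc a)) s)
      ≡⟨ ℤ.+-assoc (g 0 0) _ _ ⟩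
    g 0 0 + (sum n (λ s → g 0 (suc s)) + sum n (λ s → antidiagonal (λ a → g (suc a)) s))
      ≡⟨ cong (_+_ (g 0 0)) (sum-+ n (λ s → g 0 (suc s)) (antidiagonal (λ a → g (suc a)))) ⟨
    sum (suc n) (antidiagonal g) ∎
    where
    open ≡-Reasoning
    drop-last : ∀ a → sum (suc n) (g (suc a)) ≡ sum n (g (suc a))
    drop-last a = trans (sum-last n (g (suc a)))
                        (trans (cong (_+_ (sum n (g (suc a)))) (vanish (suc a) n (s≤s (ℕ.m≤n+m n a))))
                               (ℤ.+-identityʳ _))

  infixl 7 _⋆_
  _⋆_ : (ℕ → ℤ) → (ℕ → ℤ) → ℕ → ℤ
  (f ⋆ g) s = antidiagonal (λ a b → f a * g b) s

  -- Binomial coefficients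

  choose : ℕ → ℕ → ℤ
  choose n k = + (n C k)

  choose-pascal : ∀ n k → choose (suc n) (suc k) ≡ choose n k + choose n (suc k)
  choose-pascal n k = trans (cong +_ (sym (nCk+nC[k+1]≡[n+1]C[k+1] n k))) (ℤ.pos-+ (n C k) _)

  k>n⇒choose≡0 : ∀ {n k} → n < k → choose n k ≡ 0ℤ
  k>n⇒choose≡0 n<k = cong +_ (k>n⇒nCk≡0 n<k)

  choose-n-n : ∀ n → choose n n ≡ 1ℤ
  choose-n-n n = cong +_ (nCn≡1 n)

  [k+1]*[n+1]C[k+1]≡[n+1]*nCk : ∀ n k → + suc k * choose (suc n) (suc k) ≡ + suc n * choose n k
  [k+1]*[n+1]C[k+1]≡[n+1]*nCk zero    zero    = refl
  [k+1]*[n+1]C[k+1]≡[n+1]*nCk zero    (suc k) = ℤ.*-zeroʳ (+ suc (suc k))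
  [k+1]*[n+1]C[k+1]≡[n+1]*nCk (suc n) zero    =
    trans (ℤ.*-identityˡ _) (trans (cong +_ (nC1≡n (suc (suc n)))) (sym (ℤ.*-identityʳ _)))
  [k+1]*[n+1]C[k+1]≡[n+1]*nCk (suc n) (suc k) = begin
    K₂ * choose (suc (suc n)) (suc (suc k))
      ≡⟨ cong (K₂ *_) (choose-pascal (suc n) (suc k)) ⟩
    K₂ * (c + choose (suc n) (suc (suc k)))
      ≡⟨ ℤ.*-distribˡ-+ K₂ c _ ⟩
    K₂ * c + K₂ * choose (suc n) (suc (suc k))
      ≡⟨ cong₂ _+_ (cong (_* c) (ℤ.pos-+ 1 (suc k))) ([k+1]*[n+1]C[k+1]≡[n+1]*nCk n (suc k)) ⟩
    (1ℤ + K₁) * c + N₁ * choose n (suc k)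
      ≡⟨ cong (_+ N₁ * choose n (suc k))
              (trans (ℤ.*-distribʳ-+ c 1ℤ K₁) (cong (_+_ (1ℤ * c)) ([k+1]*[n+1]C[k+1]≡[n+1]*nCk n k))) ⟩
    1ℤ * c + N₁ * choose n k + N₁ * choose n (suc k)
      ≡⟨ regroup (1ℤ * c) N₁ (choose n k) _ ⟩
    1ℤ * c + N₁ * (choose n k + choose n (suc k))
      ≡⟨ cong (λ d → 1ℤ * c + N₁ * d) (choose-pascal n k) ⟨
    1ℤ * c + N₁ * c
      ≡⟨ ℤ.*-distribʳ-+ c 1ℤ N₁ ⟨
    (1ℤ + N₁) * c
      ≡⟨ cong (_* c) (ℤ.pos-+ 1 (suc n)) ⟨
    + suc (suc n) * c ∎
    where
    open ≡-Reasoning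
    K₁ K₂ N₁ c : ℤ
    K₁ = + suc k
    K₂ = + suc (suc k)
    N₁ = + suc n
    c  = choose (suc n) (suc k)
    regroup : ∀ u v w z → u + v * w + v * z ≡ u + v * (w + z)
    regroup = solve-∀

  [k+1]*nC[k+1]≡[n-k]*nCk : ∀ n k → + suc k * choose n (suc k) ≡ (+ n - + k) * choose n k
  [k+1]*nC[k+1]≡[n-k]*nCk n k = begin
    K₁ * choose n (suc k)
      ≡⟨ add-sub K₁ (choose n k) (choose n (suc k)) ⟩
    K₁ * (choose n k + choose n (suc k)) - K₁ * choose n k
      ≡⟨ cong (λ c → K₁ * c - K₁ * choose n k) (choose-pascal n k) ⟨
    K₁ * choose (suc n) (suc k) - K₁ * choose n k
      ≡⟨ cong (_- K₁ * choose n k) ([k+1]*[n+1]C[k+1]≡[n+1]*nCk n k) ⟩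
    + suc n * choose n k - K₁ * choose n k
      ≡⟨ cong₂ (λ u v → u * choose n k - v * choose n k) (ℤ.pos-+ 1 n) (ℤ.pos-+ 1 k) ⟩
    (1ℤ + + n) * choose n k - (1ℤ + + k) * choose n k
      ≡⟨ difference (+ n) (+ k) (choose n k) ⟩
    (+ n - + k) * choose n k ∎
    where
    open ≡-Reasoning
    K₁ : ℤ
    K₁ = + suc k
    add-sub : ∀ u c d → u * d ≡ u * (c + d) - u * c
    add-sub = solve-∀
    difference : ∀ n k c → (1ℤ + n) * c - (1ℤ + k) * c ≡ (n - k) * c
    difference = solve-∀

  central : ℕ → ℤ
  central a = choose (a ℕ.+ a) a

  -- C(2b,b)/(b+1), written without division.
  catalan : ℕ → ℤ
  catalan b = central b - choose (b ℕ.+ b) (suc b)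

  [b+1]*catalan≡central : ∀ b → + suc b * catalan b ≡ central b
  [b+1]*catalan≡central b = begin
    + suc b * (central b - choose (b ℕ.+ b) (suc b))
      ≡⟨ distrib (+ suc b) (central b) _ ⟩
    + suc b * central b - + suc b * choose (b ℕ.+ b) (suc b)
      ≡⟨ cong₂ (λ u v → u * central b - v) (ℤ.pos-+ 1 b) ([k+1]*nC[k+1]≡[n-k]*nCk (b ℕ.+ b) b) ⟩
    (1ℤ + + b) * central b - (+ (b ℕ.+ b) - + b) * central b
      ≡⟨ cong (λ u → (1ℤ + + b) * central b - (u - + b) * central b) (ℤ.pos-+ b b) ⟩
    (1ℤ + + b) * central b - (+ b + + b - + b) * central b
      ≡⟨ cancel (+ b) (central b) ⟩
    central b ∎
    where
    open ≡-Reasoning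
    distrib : ∀ k c d → k * (c - d) ≡ k * c - k * d
    distrib = solve-∀
    cancel : ∀ b c → (1ℤ + b) * c - (b + b - b) * c ≡ c
    cancel = solve-∀

  [a+1]*central[a+1]≡2[2a+1]*central : ∀ a →
    + suc a * central (suc a) ≡ + 2 * + suc (a ℕ.+ a) * central a
  [a+1]*central[a+1]≡2[2a+1]*central a = begin
    + suc a * choose (suc (a ℕ.+ suc a)) (suc a)
      ≡⟨ [k+1]*[n+1]C[k+1]≡[n+1]*nCk (a ℕ.+ suc a) a ⟩
    + suc (a ℕ.+ suc a) * choose (a ℕ.+ suc a) a
      ≡⟨ cong (+ suc (a ℕ.+ suc a) *_) (cong +_ symmetric) ⟩
    + suc (a ℕ.+ suc a) * choose (a ℕ.+ suc a) (suc a)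
      ≡⟨ cong (λ n → + suc n * choose n (suc a)) (ℕ.+-suc a a) ⟩
    + suc (suc (a ℕ.+ a)) * choose (suc (a ℕ.+ a)) (suc a)
      ≡⟨ cong (_* choose (suc (a ℕ.+ a)) (suc a)) (trans (cong +_ (double a)) (ℤ.pos-* 2 (suc a))) ⟩
    + 2 * + suc a * choose (suc (a ℕ.+ a)) (suc a)
      ≡⟨ ℤ.*-assoc (+ 2) (+ suc a) _ ⟩
    + 2 * (+ suc a * choose (suc (a ℕ.+ a)) (suc a))
      ≡⟨ cong (+ 2 *_) ([k+1]*[n+1]C[k+1]≡[n+1]*nCk (a ℕ.+ a) a) ⟩
    + 2 * (+ suc (a ℕ.+ a) * central a)
      ≡⟨ ℤ.*-assoc (+ 2) (+ suc (a ℕ.+ a)) (central a) ⟨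
    + 2 * + suc (a ℕ.+ a) * central a ∎
    where
    open ≡-Reasoning
    symmetric : (a ℕ.+ suc a) C a ≡ (a ℕ.+ suc a) C suc a
    symmetric = trans (nCk≡nC[n∸k] (ℕ.m≤m+n a (suc a))) (cong ((a ℕ.+ suc a) C_) (ℕ.m+n∸m≡n a (suc a)))
    double : ∀ a → suc (suc (a ℕ.+ a)) ≡ 2 ℕ.* suc a
    double = solve-∀ℕ

  choose-zero-⋆ : ∀ (g : ℕ → ℤ) t → (choose 0 ⋆ g) t ≡ g t
  choose-zero-⋆ g zero    = ℤ.*-identityˡ (g 0)
  choose-zero-⋆ g (suc t) =
    trans (cong₂ _+_ (ℤ.*-identityˡ (g (suc t))) (antidiagonal-zero t)) (ℤ.+-identityʳ (g (suc t)))

  vandermonde : ∀ u w t → (choose u ⋆ choose w) t ≡ choose (u ℕ.+ w) t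
  vandermonde zero    w t       = choose-zero-⋆ (choose w) t
  vandermonde (suc u) w zero    = refl
  vandermonde (suc u) w (suc t) = begin
    1ℤ * choose w (suc t) + antidiagonal (λ a b → choose (suc u) (suc a) * choose w b) t
      ≡⟨ cong (_+_ (1ℤ * choose w (suc t))) (antidiagonal-cong t split) ⟩
    1ℤ * choose w (suc t) + antidiagonal (λ a b → choose u a * choose w b + choose u (suc a) * choose w b) t
      ≡⟨ cong (_+_ (1ℤ * choose w (suc t))) (antidiagonal-+ t _ _) ⟩
    1ℤ * choose w (suc t) + ((choose u ⋆ choose w) t + antidiagonal (λ a b → choose u (suc a) * choose w b) t)
      ≡⟨ swap (choose w (suc t)) ((choose u ⋆ choose w) t) _ ⟩
    (choose u ⋆ choose w) t + (choose u ⋆ choose w) (suc t)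
      ≡⟨ cong₂ _+_ (vandermonde u w t) (vandermonde u w (suc t)) ⟩
    choose (u ℕ.+ w) t + choose (u ℕ.+ w) (suc t)
      ≡⟨ choose-pascal (u ℕ.+ w) t ⟨
    choose (suc u ℕ.+ w) (suc t) ∎
    where
    open ≡-Reasoning
    split : ∀ a b → choose (suc u) (suc a) * choose w b ≡ choose u a * choose w b + choose u (suc a) * choose w b
    split a b = trans (cong (_* choose w b) (choose-pascal u a)) (ℤ.*-distribʳ-+ (choose w b) (choose u a) (choose u (suc a)))
    swap : ∀ x y z → 1ℤ * x + (y + z) ≡ y + (1ℤ * x + z)
    swap = solve-∀

  choose-⋆-choose∘suc : ∀ u w s →
    (choose u ⋆ (λ b → choose w (suc b))) s ≡ choose (u ℕ.+ w) (suc s) - choose u (suc s)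
  choose-⋆-choose∘suc u w s = begin
    (choose u ⋆ (λ b → choose w (suc b))) s
      ≡⟨ add-sub _ (choose u (suc s)) ⟩
    (choose u ⋆ (λ b → choose w (suc b))) s + choose u (suc s) * 1ℤ - choose u (suc s)
      ≡⟨ cong (_- choose u (suc s)) (antidiagonal-sucʳ s (λ a b → choose u a * choose w b)) ⟨
    (choose u ⋆ choose w) (suc s) - choose u (suc s)
      ≡⟨ cong (_- choose u (suc s)) (vandermonde u w (suc s)) ⟩
    choose (u ℕ.+ w) (suc s) - choose u (suc s) ∎
    where
    open ≡-Reasoning
    add-sub : ∀ t c → t ≡ t + c * 1ℤ - c
    add-sub = solve-∀

  hockey-stick : ∀ r n → ((λ k → choose k r) ⋆ (λ _ → 1ℤ)) n ≡ choose (suc n) (suc r)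
  hockey-stick r zero    = trans (ℤ.*-identityʳ (choose 0 r)) (sym (trans (choose-pascal 0 r) (ℤ.+-identityʳ _)))
  hockey-stick r (suc n) = begin
    ((λ k → choose k r) ⋆ (λ _ → 1ℤ)) (suc n)
      ≡⟨ antidiagonal-sucʳ n (λ a _ → choose a r * 1ℤ) ⟩
    ((λ k → choose k r) ⋆ (λ _ → 1ℤ)) n + choose (suc n) r * 1ℤ
      ≡⟨ cong₂ _+_ (hockey-stick r n) (ℤ.*-identityʳ (choose (suc n) r)) ⟩
    choose (suc n) (suc r) + choose (suc n) r
      ≡⟨ ℤ.+-comm (choose (suc n) (suc r)) (choose (suc n) r) ⟩
    choose (suc n) r + choose (suc n) (suc r)
      ≡⟨ choose-pascal (suc n) r ⟨
    choose (suc (suc n)) (suc r) ∎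
    where open ≡-Reasoning

  choose-⋆-choose : ∀ r s n → ((λ k → choose k r) ⋆ (λ j → choose j s)) n ≡ choose (suc n) (suc (r ℕ.+ s))
  choose-⋆-choose r zero    n       = trans (hockey-stick r n) (cong (λ t → choose (suc n) (suc t)) (sym (ℕ.+-identityʳ r)))
  choose-⋆-choose r (suc s) zero    =
    trans (ℤ.*-zeroʳ (choose 0 r)) (sym (k>n⇒choose≡0 (s≤s (subst (1 ≤_) (sym (ℕ.+-suc r s)) (s≤s z≤n)))))
  choose-⋆-choose r (suc s) (suc n) = begin
    (f ⋆ (λ j → choose j (suc s))) (suc n)
      ≡⟨ antidiagonal-sucʳ n (λ a b → f a * choose b (suc s)) ⟩
    (f ⋆ (λ j → choose (suc j) (suc s))) n + f (suc n) * 0ℤ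
      ≡⟨ cong₂ _+_ (antidiagonal-cong n split) (ℤ.*-zeroʳ (f (suc n))) ⟩
    antidiagonal (λ a b → f a * choose b s + f a * choose b (suc s)) n + 0ℤ
      ≡⟨ ℤ.+-identityʳ _ ⟩
    antidiagonal (λ a b → f a * choose b s + f a * choose b (suc s)) n
      ≡⟨ antidiagonal-+ n _ _ ⟩
    (f ⋆ (λ j → choose j s)) n + (f ⋆ (λ j → choose j (suc s))) n
      ≡⟨ cong₂ _+_ (choose-⋆-choose r s n) (choose-⋆-choose r (suc s) n) ⟩
    choose (suc n) (suc (r ℕ.+ s)) + choose (suc n) (suc (r ℕ.+ suc s))
      ≡⟨ cong (λ t → choose (suc n) (suc (r ℕ.+ s)) + choose (suc n) (suc t)) (ℕ.+-suc r s) ⟩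
    choose (suc n) (suc (r ℕ.+ s)) + choose (suc n) (suc (suc (r ℕ.+ s)))
      ≡⟨ choose-pascal (suc n) (suc (r ℕ.+ s)) ⟨
    choose (suc (suc n)) (suc (suc (r ℕ.+ s)))
      ≡⟨ cong (λ t → choose (suc (suc n)) (suc t)) (ℕ.+-suc r s) ⟨
    choose (suc (suc n)) (suc (r ℕ.+ suc s)) ∎
    where
    open ≡-Reasoning
    f : ℕ → ℤ
    f k = choose k r
    split : ∀ a b → f a * choose (suc b) (suc s) ≡ f a * choose b s + f a * choose b (suc s)
    split a b = trans (cong (f a *_) (choose-pascal b s)) (ℤ.*-distribˡ-+ (f a) (choose b s) (choose b (suc s)))

  shifted-choose-⋆-choose : ∀ a b n →
    ((λ k → choose (k ℕ.+ a) (a ℕ.+ a)) ⋆ (λ j → choose (j ℕ.+ b) (b ℕ.+ b))) n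
      ≡ choose (suc (n ℕ.+ (a ℕ.+ b))) (suc ((a ℕ.+ b) ℕ.+ (a ℕ.+ b)))
  shifted-choose-⋆-choose a b n = begin
    antidiagonal (λ k j → choose (k ℕ.+ a) (a ℕ.+ a) * choose (j ℕ.+ b) (b ℕ.+ b)) n
      ≡⟨ antidiagonal-cong n (λ k j → cong₂ (λ u v → choose u (a ℕ.+ a) * choose v (b ℕ.+ b))
                                            (ℕ.+-comm k a) (ℕ.+-comm j b)) ⟩
    antidiagonal (λ k j → g (a ℕ.+ k) (b ℕ.+ j)) n
      ≡⟨ antidiagonal-shiftʳ b n (λ k → g (a ℕ.+ k)) (λ k → vanishʳ (a ℕ.+ k)) ⟨
    antidiagonal (λ k → g (a ℕ.+ k)) (b ℕ.+ n)
      ≡⟨ antidiagonal-shiftˡ a (b ℕ.+ n) g vanishˡ ⟨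
    antidiagonal g (a ℕ.+ (b ℕ.+ n))
      ≡⟨ choose-⋆-choose (a ℕ.+ a) (b ℕ.+ b) (a ℕ.+ (b ℕ.+ n)) ⟩
    choose (suc (a ℕ.+ (b ℕ.+ n))) (suc ((a ℕ.+ a) ℕ.+ (b ℕ.+ b)))
      ≡⟨ cong₂ (λ u v → choose (suc u) (suc v)) (reorder₁ a b n) (reorder₂ a b) ⟩
    choose (suc (n ℕ.+ (a ℕ.+ b))) (suc ((a ℕ.+ b) ℕ.+ (a ℕ.+ b))) ∎
    where
    open ≡-Reasoning
    g : ℕ → ℕ → ℤ
    g k j = choose k (a ℕ.+ a) * choose j (b ℕ.+ b)
    vanishˡ : ∀ k j → k < a → g k j ≡ 0ℤ
    vanishˡ k j k<a = trans (cong (_* choose j (b ℕ.+ b)) (k>n⇒choose≡0 (ℕ.<-≤-trans k<a (ℕ.m≤m+n a a))))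
                            (ℤ.*-zeroˡ (choose j (b ℕ.+ b)))
    vanishʳ : ∀ k j → j < b → g k j ≡ 0ℤ
    vanishʳ k j j<b = trans (cong (choose k (a ℕ.+ a) *_) (k>n⇒choose≡0 (ℕ.<-≤-trans j<b (ℕ.m≤m+n b b))))
                            (ℤ.*-zeroʳ (choose k (a ℕ.+ a)))
    reorder₁ : ∀ a b n → a ℕ.+ (b ℕ.+ n) ≡ n ℕ.+ (a ℕ.+ b)
    reorder₁ = solve-∀ℕ
    reorder₂ : ∀ a b → (a ℕ.+ a) ℕ.+ (b ℕ.+ b) ≡ (a ℕ.+ b) ℕ.+ (a ℕ.+ b)
    reorder₂ = solve-∀ℕ

  binomial-theorem : ∀ n x → (x + 1ℤ) ^ n ≡ sum (suc n) (λ i → choose n i * x ^ i)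
  binomial-theorem zero    x = refl
  binomial-theorem (suc n) x = begin
    (x + 1ℤ) * P
      ≡⟨ ℤ.*-distribʳ-+ P x 1ℤ ⟩
    x * P + 1ℤ * P
      ≡⟨ cong₂ _+_ (trans (cong (x *_) (binomial-theorem n x)) (sym (sum-*ˡ (suc n) x (f n))))
                   (trans (ℤ.*-identityˡ P) (trans (binomial-theorem n x) (sum-extend (f n) vanish (ℕ.n≤1+n (suc n))))) ⟩
    sum (suc n) (λ i → x * f n i) + (1ℤ * 1ℤ + sum (suc n) (λ i → f n (suc i)))
      ≡⟨ regroup (sum (suc n) (λ i → x * f n i)) (sum (suc n) (λ i → f n (suc i))) ⟩
    1ℤ * 1ℤ + (sum (suc n) (λ i → x * f n i) + sum (suc n) (λ i → f n (suc i)))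
      ≡⟨ cong (_+_ (1ℤ * 1ℤ)) (sum-+ (suc n) (λ i → x * f n i) (λ i → f n (suc i))) ⟨
    1ℤ * 1ℤ + sum (suc n) (λ i → x * f n i + f n (suc i))
      ≡⟨ cong (_+_ (1ℤ * 1ℤ)) (sum-cong (suc n) (λ i _ → pascal i)) ⟩
    sum (suc (suc n)) (f (suc n)) ∎
    where
    open ≡-Reasoning
    P : ℤ
    P = (x + 1ℤ) ^ n
    f : ℕ → ℕ → ℤ
    f n i = choose n i * x ^ i
    vanish : ∀ i → suc n ≤ i → f n i ≡ 0ℤ
    vanish i n<i = trans (cong (_* x ^ i) (k>n⇒choose≡0 n<i)) (ℤ.*-zeroˡ (x ^ i))
    regroup : ∀ a b → a + (1ℤ * 1ℤ + b) ≡ 1ℤ * 1ℤ + (a + b)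
    regroup = solve-∀
    pascal : ∀ i → x * f n i + f n (suc i) ≡ f (suc n) (suc i)
    pascal i = begin
      x * (choose n i * x ^ i) + choose n (suc i) * x ^ suc i
        ≡⟨ cong (_+ choose n (suc i) * x ^ suc i) (x*[c*y]≡c*[x*y] x (choose n i) (x ^ i)) ⟩
      choose n i * x ^ suc i + choose n (suc i) * x ^ suc i
        ≡⟨ ℤ.*-distribʳ-+ (x ^ suc i) (choose n i) (choose n (suc i)) ⟨
      (choose n i + choose n (suc i)) * x ^ suc i
        ≡⟨ cong (_* x ^ suc i) (choose-pascal n i) ⟨
      choose (suc n) (suc i) * x ^ suc i ∎
      where
      x*[c*y]≡c*[x*y] : ∀ x c y → x * (c * y) ≡ c * (x * y)
      x*[c*y]≡c*[x*y] = solve-∀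

  -- Falling factorials

  falling : ℤ → ℕ → ℤ
  falling c zero    = 1ℤ
  falling c (suc r) = c * falling (c - 1ℤ) r

  falling-choose : ∀ n r → falling (+ n) r ≡ + (r !) * choose n r
  falling-choose n       zero    = refl
  falling-choose zero    (suc r) = sym (ℤ.*-zeroʳ (+ (suc r !)))
  falling-choose (suc n) (suc r) = begin
    + suc n * falling (+ n) r
      ≡⟨ cong (+ suc n *_) (falling-choose n r) ⟩
    + suc n * (+ (r !) * choose n r)
      ≡⟨ x*[y*z]≡y*[x*z] (+ suc n) (+ (r !)) (choose n r) ⟩
    + (r !) * (+ suc n * choose n r)
      ≡⟨ cong (+ (r !) *_) ([k+1]*[n+1]C[k+1]≡[n+1]*nCk n r) ⟨
    + (r !) * (+ suc r * choose (suc n) (suc r))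
      ≡⟨ x*[y*z]≡y*[x*z] (+ (r !)) (+ suc r) (choose (suc n) (suc r)) ⟩
    + suc r * (+ (r !) * choose (suc n) (suc r))
      ≡⟨ ℤ.*-assoc (+ suc r) (+ (r !)) _ ⟨
    + suc r * + (r !) * choose (suc n) (suc r)
      ≡⟨ cong (_* choose (suc n) (suc r)) (ℤ.pos-* (suc r) (r !)) ⟨
    + (suc r !) * choose (suc n) (suc r) ∎
    where
    open ≡-Reasoning
    x*[y*z]≡y*[x*z] : ∀ x y z → x * (y * z) ≡ y * (x * z)
    x*[y*z]≡y*[x*z] = solve-∀

  falling-+ : ∀ c r s → falling c (r ℕ.+ s) ≡ falling c r * falling (c - + r) s
  falling-+ c zero    s = sym (trans (ℤ.*-identityˡ _) (cong (λ d → falling d s) (ℤ.+-identityʳ c)))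
  falling-+ c (suc r) s = begin
    c * falling (c - 1ℤ) (r ℕ.+ s)
      ≡⟨ cong (c *_) (falling-+ (c - 1ℤ) r s) ⟩
    c * (falling (c - 1ℤ) r * falling (c - 1ℤ - + r) s)
      ≡⟨ ℤ.*-assoc c _ _ ⟨
    c * falling (c - 1ℤ) r * falling (c - 1ℤ - + r) s
      ≡⟨ cong (λ d → c * falling (c - 1ℤ) r * falling d s)
              (trans (cong (_-_ c) (ℤ.pos-+ 1 r)) (shift c (+ r))) ⟨
    c * falling (c - 1ℤ) r * falling (c - + suc r) s ∎
    where
    open ≡-Reasoning
    shift : ∀ c r → c - (1ℤ + r) ≡ c - 1ℤ - r
    shift = solve-∀

  falling-last : ∀ c r → falling c (suc r) ≡ falling c r * (c - + r)
  falling-last c r = begin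
    falling c (suc r)                     ≡⟨ cong (falling c) (ℕ.+-comm r 1) ⟨
    falling c (r ℕ.+ 1)                   ≡⟨ falling-+ c r 1 ⟩
    falling c r * ((c - + r) * 1ℤ)        ≡⟨ cong (falling c r *_) (ℤ.*-identityʳ (c - + r)) ⟩
    falling c r * (c - + r)               ∎
    where open ≡-Reasoning

  falling-reflect : ∀ r c → falling c r ≡ (-1ℤ) ^ r * falling (+ r - c - 1ℤ) r
  falling-reflect zero    c = refl
  falling-reflect (suc r) c = begin
    c * falling (c - 1ℤ) r
      ≡⟨ cong (c *_) (falling-reflect r (c - 1ℤ)) ⟩
    c * ((-1ℤ) ^ r * falling (+ r - (c - 1ℤ) - 1ℤ) r)
      ≡⟨ cong (λ d → c * ((-1ℤ) ^ r * falling d r)) (simplify (+ r) c) ⟩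
    c * ((-1ℤ) ^ r * falling (+ r - c) r)
      ≡⟨ flip-sign c (+ r) ((-1ℤ) ^ r) (falling (+ r - c) r) ⟩
    -1ℤ * (-1ℤ) ^ r * (falling (+ r - c) r * (+ r - c - + r))
      ≡⟨ cong (-1ℤ * (-1ℤ) ^ r *_) (falling-last (+ r - c) r) ⟨
    -1ℤ * (-1ℤ) ^ r * falling (+ r - c) (suc r)
      ≡⟨ cong (λ d → -1ℤ * (-1ℤ) ^ r * falling d (suc r))
              (trans (cong (λ n → n - c - 1ℤ) (ℤ.pos-+ 1 r)) (simplify′ (+ r) c)) ⟨
    -1ℤ * (-1ℤ) ^ r * falling (+ suc r - c - 1ℤ) (suc r) ∎
    where
    open ≡-Reasoning
    simplify : ∀ r c → r - (c - 1ℤ) - 1ℤ ≡ r - c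
    simplify = solve-∀
    simplify′ : ∀ r c → 1ℤ + r - c - 1ℤ ≡ r - c
    simplify′ = solve-∀
    flip-sign : ∀ c r s f → c * (s * f) ≡ -1ℤ * s * (f * (r - c - r))
    flip-sign = solve-∀

  ^-distribʳ-* : ∀ a b n → (a * b) ^ n ≡ a ^ n * b ^ n
  ^-distribʳ-* a b zero    = refl
  ^-distribʳ-* a b (suc n) = trans (cong (a * b *_) (^-distribʳ-* a b n)) (interchange a b (a ^ n) (b ^ n))
    where
    interchange : ∀ a b c d → a * b * (c * d) ≡ a * c * (b * d)
    interchange = solve-∀

  -1^[n+n]≡1 : ∀ n → (-1ℤ) ^ (n ℕ.+ n) ≡ 1ℤ
  -1^[n+n]≡1 zero    = refl
  -1^[n+n]≡1 (suc n) = begin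
    -1ℤ * (-1ℤ) ^ (n ℕ.+ suc n)       ≡⟨ cong (λ k → -1ℤ * (-1ℤ) ^ k) (ℕ.+-suc n n) ⟩
    -1ℤ * (-1ℤ * (-1ℤ) ^ (n ℕ.+ n))   ≡⟨ square (-1ℤ ^ (n ℕ.+ n)) ⟩
    (-1ℤ) ^ (n ℕ.+ n)                 ≡⟨ -1^[n+n]≡1 n ⟩
    1ℤ                                ∎
    where
    open ≡-Reasoning
    square : ∀ y → -1ℤ * (-1ℤ * y) ≡ y
    square = solve-∀

  +[m+n]-+n≡+m : ∀ m n → + (m ℕ.+ n) - + n ≡ + m
  +[m+n]-+n≡+m m n = trans (cong (_- + n) (ℤ.pos-+ m n)) (cancel (+ m) (+ n))
    where
    cancel : ∀ m n → m + n - n ≡ m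
    cancel = solve-∀

  falling-reflect-even : ∀ k j b →
    falling (+ (k ℕ.+ b)) (b ℕ.+ b) ≡ falling (+ (j ℕ.+ b) - + suc (k ℕ.+ j)) (b ℕ.+ b)
  falling-reflect-even k j b = begin
    falling (+ (k ℕ.+ b)) (b ℕ.+ b)
      ≡⟨ falling-reflect (b ℕ.+ b) (+ (k ℕ.+ b)) ⟩
    (-1ℤ) ^ (b ℕ.+ b) * falling (+ (b ℕ.+ b) - + (k ℕ.+ b) - 1ℤ) (b ℕ.+ b)
      ≡⟨ cong₂ (λ s c → s * falling c (b ℕ.+ b)) (-1^[n+n]≡1 b) offset ⟩
    1ℤ * falling (+ (j ℕ.+ b) - + suc (k ℕ.+ j)) (b ℕ.+ b)
      ≡⟨ ℤ.*-identityˡ _ ⟩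
    falling (+ (j ℕ.+ b) - + suc (k ℕ.+ j)) (b ℕ.+ b) ∎
    where
    open ≡-Reasoning
    rearrange : ∀ j k b → b + b - (k + b) - 1ℤ ≡ j + b - (1ℤ + (k + j))
    rearrange = solve-∀
    offset : + (b ℕ.+ b) - + (k ℕ.+ b) - 1ℤ ≡ + (j ℕ.+ b) - + suc (k ℕ.+ j)
    offset = begin
      + (b ℕ.+ b) - + (k ℕ.+ b) - 1ℤ
        ≡⟨ cong₂ (λ u v → u - v - 1ℤ) (ℤ.pos-+ b b) (ℤ.pos-+ k b) ⟩
      + b + + b - (+ k + + b) - 1ℤ
        ≡⟨ rearrange (+ j) (+ k) (+ b) ⟩
      + j + + b - (1ℤ + (+ k + + j))
        ≡⟨ cong₂ (λ u v → u - (1ℤ + v)) (ℤ.pos-+ j b) (ℤ.pos-+ k j) ⟨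
      + (j ℕ.+ b) - (1ℤ + + (k ℕ.+ j))
        ≡⟨ cong (λ u → + (j ℕ.+ b) - u) (ℤ.pos-+ 1 (k ℕ.+ j)) ⟨
      + (j ℕ.+ b) - + suc (k ℕ.+ j) ∎

  [2a]!≡a!*central*a! : ∀ a → + ((a ℕ.+ a) !) ≡ + (a !) * central a * + (a !)
  [2a]!≡a!*central*a! a = begin
    + ((a ℕ.+ a) !)
      ≡⟨ ℤ.*-identityʳ _ ⟨
    + ((a ℕ.+ a) !) * 1ℤ
      ≡⟨ cong (+ ((a ℕ.+ a) !) *_) (choose-n-n (a ℕ.+ a)) ⟨
    + ((a ℕ.+ a) !) * choose (a ℕ.+ a) (a ℕ.+ a)
      ≡⟨ falling-choose (a ℕ.+ a) (a ℕ.+ a) ⟨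
    falling (+ (a ℕ.+ a)) (a ℕ.+ a)
      ≡⟨ falling-+ (+ (a ℕ.+ a)) a a ⟩
    falling (+ (a ℕ.+ a)) a * falling (+ (a ℕ.+ a) - + a) a
      ≡⟨ cong₂ _*_ (falling-choose (a ℕ.+ a) a) (cong (λ c → falling c a) (+[m+n]-+n≡+m a a)) ⟩
    + (a !) * central a * falling (+ a) a
      ≡⟨ cong (+ (a !) * central a *_) (trans (falling-choose a a) (cong (+ (a !) *_) (choose-n-n a))) ⟩
    + (a !) * central a * (+ (a !) * 1ℤ)
      ≡⟨ cong (+ (a !) * central a *_) (ℤ.*-identityʳ (+ (a !))) ⟩
    + (a !) * central a * + (a !) ∎
    where open ≡-Reasoning

  nCa*[n+a]Ca≡central*[n+a]C[2a] : ∀ n a →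
    choose n a * choose (n ℕ.+ a) a ≡ central a * choose (n ℕ.+ a) (a ℕ.+ a)
  nCa*[n+a]Ca≡central*[n+a]C[2a] n a =
    ℤ.*-cancelˡ-≡ A _ _ (ℤ.*-cancelˡ-≡ A _ _ (begin
      A * (A * (choose n a * choose (n ℕ.+ a) a))
        ≡⟨ regroup₁ A (choose n a) (choose (n ℕ.+ a) a) ⟩
      A * choose (n ℕ.+ a) a * (A * choose n a)
        ≡⟨ cong₂ _*_ (falling-choose (n ℕ.+ a) a) (falling-choose n a) ⟨
      falling (+ (n ℕ.+ a)) a * falling (+ n) a
        ≡⟨ cong (λ c → falling (+ (n ℕ.+ a)) a * falling c a) (+[m+n]-+n≡+m n a) ⟨
      falling (+ (n ℕ.+ a)) a * falling (+ (n ℕ.+ a) - + a) a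
        ≡⟨ falling-+ (+ (n ℕ.+ a)) a a ⟨
      falling (+ (n ℕ.+ a)) (a ℕ.+ a)
        ≡⟨ falling-choose (n ℕ.+ a) (a ℕ.+ a) ⟩
      + ((a ℕ.+ a) !) * choose (n ℕ.+ a) (a ℕ.+ a)
        ≡⟨ cong (_* choose (n ℕ.+ a) (a ℕ.+ a)) ([2a]!≡a!*central*a! a) ⟩
      A * central a * A * choose (n ℕ.+ a) (a ℕ.+ a)
        ≡⟨ regroup₂ A (central a) (choose (n ℕ.+ a) (a ℕ.+ a)) ⟩
      A * (A * (central a * choose (n ℕ.+ a) (a ℕ.+ a))) ∎))
    where
    open ≡-Reasoning
    A : ℤ
    A = + (a !)
    instance
      _ : ℕ.NonZero (a !)
      _ = a ℕ.!≢0
    regroup₁ : ∀ A c d → A * (A * (c * d)) ≡ A * d * (A * c)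
    regroup₁ = solve-∀
    regroup₂ : ∀ A c d → A * c * A * d ≡ A * (A * (c * d))
    regroup₂ = solve-∀

  infix 4 _≡_mod_
  -- A record rather than a synonym for divisibility, so that a and b can be inferred.
  record _≡_mod_ (a b : ℤ) (n : ℕ) : Set where
    constructor from∣
    field to∣ : + n Signed.∣ a - b

  module _ {n : ℕ} where

    mod-refl : ∀ {a} → a ≡ a mod n
    mod-refl {a} = from∣ (Signed.divides 0ℤ (ℤ.+-inverseʳ a))

    ≡⇒≡mod : ∀ {a b} → a ≡ b → a ≡ b mod n
    ≡⇒≡mod refl = mod-refl

    mod-sym : ∀ {a b} → a ≡ b mod n → b ≡ a mod n
    mod-sym {a} {b} (from∣ a≡b) = from∣ (subst (+ n Signed.∣_) (negate a b) (Signed.∣m⇒∣-m a≡b))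
      where
      negate : ∀ a b → - (a - b) ≡ b - a
      negate = solve-∀

    mod-trans : ∀ {a b c} → a ≡ b mod n → b ≡ c mod n → a ≡ c mod n
    mod-trans {a} {b} {c} (from∣ a≡b) (from∣ b≡c) =
      from∣ (subst (+ n Signed.∣_) (telescope a b c) (Signed.∣m∣n⇒∣m+n a≡b b≡c))
      where
      telescope : ∀ a b c → a - b + (b - c) ≡ a - c
      telescope = solve-∀

    +-cong-mod : ∀ {a b c d} → a ≡ b mod n → c ≡ d mod n → a + c ≡ b + d mod n
    +-cong-mod {a} {b} {c} {d} (from∣ a≡b) (from∣ c≡d) =
      from∣ (subst (+ n Signed.∣_) (regroup a b c d) (Signed.∣m∣n⇒∣m+n a≡b c≡d))
      where
      regroup : ∀ a b c d → a - b + (c - d) ≡ a + c - (b + d)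
      regroup = solve-∀

    *-cong-mod : ∀ {a b c d} → a ≡ b mod n → c ≡ d mod n → a * c ≡ b * d mod n
    *-cong-mod {a} {b} {c} {d} (from∣ a≡b) (from∣ c≡d) =
      from∣ (subst (+ n Signed.∣_) (regroup a b c d)
                   (Signed.∣m∣n⇒∣m+n (Signed.∣m⇒∣m*n c a≡b) (Signed.∣n⇒∣m*n b c≡d)))
      where
      regroup : ∀ a b c d → (a - b) * c + b * (c - d) ≡ a * c - b * d
      regroup = solve-∀

    neg-cong-mod : ∀ {a b} → a ≡ b mod n → - a ≡ - b mod n
    neg-cong-mod {a} {b} (from∣ a≡b) = from∣ (subst (+ n Signed.∣_) (negate a b) (Signed.∣m⇒∣-m a≡b))
      where
      negate : ∀ a b → - (a - b) ≡ - a - - b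
      negate = solve-∀

    ^-cong-mod : ∀ {a b} k → a ≡ b mod n → a ^ k ≡ b ^ k mod n
    ^-cong-mod zero    a≡b = mod-refl
    ^-cong-mod (suc k) a≡b = *-cong-mod a≡b (^-cong-mod k a≡b)

    sum-cong-mod : ∀ k {f g : ℕ → ℤ} → (∀ i → i < k → f i ≡ g i mod n) → sum k f ≡ sum k g mod n
    sum-cong-mod zero    f≡g = mod-refl
    sum-cong-mod (suc k) f≡g = +-cong-mod (f≡g 0 (s≤s z≤n)) (sum-cong-mod k (λ i i<k → f≡g (suc i) (s≤s i<k)))

    sum≡0-mod : ∀ k (f : ℕ → ℤ) → (∀ i → i < k → f i ≡ 0ℤ mod n) → sum k f ≡ 0ℤ mod n
    sum≡0-mod k f f≡0 = mod-trans (sum-cong-mod k f≡0) (≡⇒≡mod (sum-zero k (λ _ → 0ℤ) (λ _ _ → refl)))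

    falling-cong-mod : ∀ {c d} r → c ≡ d mod n → falling c r ≡ falling d r mod n
    falling-cong-mod zero    c≡d = mod-refl
    falling-cong-mod (suc r) c≡d = *-cong-mod c≡d (falling-cong-mod r (+-cong-mod c≡d mod-refl))

    +[m+n]≡+m-mod : ∀ m → + (m ℕ.+ n) ≡ + m mod n
    +[m+n]≡+m-mod m = from∣ (Signed.divides 1ℤ (trans (cong (_- + m) (ℤ.pos-+ m n)) (cancel (+ m) (+ n))))
      where
      cancel : ∀ m n → m + n - m ≡ 1ℤ * n
      cancel = solve-∀

    x-n≡x-mod : ∀ x → x - + n ≡ x mod n
    x-n≡x-mod x = from∣ (Signed.divides -1ℤ (offset x (+ n)))
      where
      offset : ∀ x n → x - n - x ≡ -1ℤ * n
      offset = solve-∀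

  mod-setoid : ℕ → Setoid 0ℓ 0ℓ
  mod-setoid n = record
    { Carrier       = ℤ
    ; _≈_           = λ a b → a ≡ b mod n
    ; isEquivalence = record { refl = mod-refl ; sym = mod-sym ; trans = mod-trans }
    }

  module mod-Reasoning (n : ℕ) = SetoidReasoning (mod-setoid n)

  -- Modulo a prime

  module _ {p : ℕ} (prime : Prime p) where

    private instance
      p≢0 : ℕ.NonZero p
      p≢0 = prime⇒nonZero prime

    p>1 : 1 < p
    p>1 = ℕ.nonTrivial⇒n>1 p {{prime⇒nonTrivial prime}}

    cancel-mod : ∀ z {a b} → ¬ p ∣ ∣ z ∣ → z * a ≡ z * b mod p → a ≡ b mod p
    cancel-mod z {a} {b} p∤z (from∣ p∣za-zb) with euclidsLemma ∣ z ∣ ∣ a - b ∣ prime p∣∣z∣∣a-b∣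
      where
      factor : ∀ z a b → z * a - z * b ≡ z * (a - b)
      factor = solve-∀
      p∣∣z∣∣a-b∣ : p ∣ ∣ z ∣ ℕ.* ∣ a - b ∣
      p∣∣z∣∣a-b∣ = subst (p ∣_) (ℤ.abs-* z (a - b)) (Signed.∣⇒∣ᵤ (subst (+ p Signed.∣_) (factor z a b) p∣za-zb))
    ... | inj₁ p∣z   = contradiction p∣z p∤z
    ... | inj₂ p∣a-b = from∣ (Signed.∣ᵤ⇒∣ p∣a-b)

    0<k<p⇒p∤k : ∀ {k} → 0 < k → k < p → ¬ p ∣ k
    0<k<p⇒p∤k 0<k k<p p∣k = ℕ.<⇒≱ k<p (∣⇒≤ {{ℕ.>-nonZero 0<k}} p∣k)

    r<p⇒p∤r! : ∀ {r} → r < p → ¬ p ∣ r !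
    r<p⇒p∤r! {zero}  _   p∣1 = ℕ.<-irrefl (sym (∣1⇒≡1 p∣1)) p>1
    r<p⇒p∤r! {suc r} r<p p∣r! with euclidsLemma (suc r) (r !) prime p∣r!
    ... | inj₁ p∣1+r = 0<k<p⇒p∤k (s≤s z≤n) r<p p∣1+r
    ... | inj₂ p∣r!  = r<p⇒p∤r! (ℕ.<-trans (ℕ.n<1+n r) r<p) p∣r!

    choose[n+p]≡choose-mod : ∀ n {r} → r < p → choose (n ℕ.+ p) r ≡ choose n r mod p
    choose[n+p]≡choose-mod n {r} r<p = cancel-mod (+ (r !)) (r<p⇒p∤r! r<p) (begin
      + (r !) * choose (n ℕ.+ p) r   ≡⟨ falling-choose (n ℕ.+ p) r ⟨
      falling (+ (n ℕ.+ p)) r       ≈⟨ falling-cong-mod r (+[m+n]≡+m-mod n) ⟩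
      falling (+ n) r               ≡⟨ falling-choose n r ⟩
      + (r !) * choose n r          ∎)
      where open mod-Reasoning p

    freshman : ∀ y → (y + 1ℤ) ^ p ≡ y ^ p + 1ℤ mod p
    freshman y = begin
      (y + 1ℤ) ^ p                                           ≡⟨ binomial-theorem p y ⟩
      sum (suc p) (λ i → choose p i * y ^ i)                 ≡⟨ sum-last p (λ i → choose p i * y ^ i) ⟩
      sum p (λ i → choose p i * y ^ i) + choose p p * y ^ p
        ≈⟨ +-cong-mod (sum-cong-mod p (λ i i<p → *-cong-mod (choose[n+p]≡choose-mod 0 i<p) mod-refl)) mod-refl ⟩
      sum p (λ i → choose 0 i * y ^ i) + choose p p * y ^ p
        ≡⟨ cong₂ _+_ (sym (sum-extend (λ i → choose 0 i * y ^ i) vanish (ℕ.<⇒≤ p>1)))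
                     (trans (cong (_* y ^ p) (choose-n-n p)) (ℤ.*-identityˡ (y ^ p))) ⟩
      1ℤ + y ^ p                                             ≡⟨ ℤ.+-comm 1ℤ (y ^ p) ⟩
      y ^ p + 1ℤ                                             ∎
      where
      open mod-Reasoning p
      vanish : ∀ i → 1 ≤ i → choose 0 i * y ^ i ≡ 0ℤ
      vanish i 0<i = trans (cong (_* y ^ i) (k>n⇒choose≡0 0<i)) (ℤ.*-zeroˡ (y ^ i))

    fermat-ℕ : ∀ a → (+ a) ^ p ≡ + a mod p
    fermat-ℕ zero    = ≡⇒≡mod (cong (0ℤ ^_) (sym (ℕ.suc-pred p)))
    fermat-ℕ (suc a) = begin
      (+ suc a) ^ p        ≡⟨ cong (_^ p) +suc ⟩
      (+ a + 1ℤ) ^ p       ≈⟨ freshman (+ a) ⟩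
      (+ a) ^ p + 1ℤ       ≈⟨ +-cong-mod (fermat-ℕ a) mod-refl ⟩
      + a + 1ℤ             ≡⟨ +suc ⟨
      + suc a              ∎
      where
      open mod-Reasoning p
      +suc : + suc a ≡ + a + 1ℤ
      +suc = trans (ℤ.pos-+ 1 a) (ℤ.+-comm 1ℤ (+ a))

    fermat : ∀ x → x ^ p ≡ x mod p
    fermat x = begin
      x ^ p                   ≈⟨ ^-cong-mod p x≡r ⟩
      (+ (x %ℕ p)) ^ p        ≈⟨ fermat-ℕ (x %ℕ p) ⟩
      + (x %ℕ p)              ≈⟨ x≡r ⟨
      x                       ∎
      where
      open mod-Reasoning p
      remainder : ∀ x r q → x ≡ r + q * + p → x - r ≡ q * + p
      remainder x r q refl = cancel r q (+ p)
        where
        cancel : ∀ r q P → r + q * P - r ≡ q * P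
        cancel = solve-∀
      x≡r : x ≡ + (x %ℕ p) mod p
      x≡r = from∣ (Signed.divides (x /ℕ p) (remainder x (+ (x %ℕ p)) (x /ℕ p) (a≡a%ℕn+[a/ℕn]*n x p)))

    fermat-little : ∀ x → ¬ p ∣ ∣ x ∣ → x ^ (p ∸ 1) ≡ 1ℤ mod p
    fermat-little x p∤x = cancel-mod x p∤x (begin
      x * x ^ (p ∸ 1)    ≡⟨ cong (x ^_) (ℕ.suc-pred p) ⟩
      x ^ p              ≈⟨ fermat x ⟩
      x                  ≡⟨ ℤ.*-identityʳ x ⟨
      x * 1ℤ             ∎)
      where open mod-Reasoning p


    choose-reflect-mod : ∀ {k j} b → suc (k ℕ.+ j) ≡ p → b ℕ.+ b < p →
                         choose (k ℕ.+ b) (b ℕ.+ b) ≡ choose (j ℕ.+ b) (b ℕ.+ b) mod p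
    choose-reflect-mod {k} {j} b refl 2b<p = cancel-mod (+ (r !)) (r<p⇒p∤r! 2b<p) (begin
      + (r !) * choose (k ℕ.+ b) r    ≡⟨ falling-choose (k ℕ.+ b) r ⟨
      falling (+ (k ℕ.+ b)) r         ≡⟨ falling-reflect-even k j b ⟩
      falling (+ (j ℕ.+ b) - + p) r   ≈⟨ falling-cong-mod r (x-n≡x-mod (+ (j ℕ.+ b))) ⟩
      falling (+ (j ℕ.+ b)) r         ≡⟨ falling-choose (j ℕ.+ b) r ⟩
      + (r !) * choose (j ℕ.+ b) r    ∎)
      where
      r : ℕ
      r = b ℕ.+ b
      open mod-Reasoning p

  catalan[p-1]≡-1 : ∀ n → Prime (suc (suc n)) → catalan (suc n) ≡ -1ℤ mod suc (suc n)
  catalan[p-1]≡-1 n p-prime = begin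
    choose (suc n ℕ.+ suc n) (suc n) - choose (suc n ℕ.+ suc n) (suc (suc n))
      ≡⟨ cong (_-_ (choose (suc n ℕ.+ suc n) (suc n))) (cong +_ symmetric) ⟩
    choose (suc n ℕ.+ suc n) (suc n) - choose (suc n ℕ.+ suc n) n
      ≡⟨ cong (λ t → choose t (suc n) - choose t n) (sym (ℕ.+-suc n (suc n))) ⟩
    choose (n ℕ.+ p) (suc n) - choose (n ℕ.+ p) n
      ≈⟨ +-cong-mod (choose[n+p]≡choose-mod p-prime n (ℕ.n<1+n (suc n)))
                    (neg-cong-mod (choose[n+p]≡choose-mod p-prime n (ℕ.<-trans (ℕ.n<1+n n) (ℕ.n<1+n (suc n))))) ⟩
    choose n (suc n) - choose n n
      ≡⟨ cong₂ _-_ (k>n⇒choose≡0 (ℕ.n<1+n n)) (choose-n-n n) ⟩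
    -1ℤ ∎
    where
    p : ℕ
    p = suc (suc n)
    open mod-Reasoning p
    symmetric : (suc n ℕ.+ suc n) C suc (suc n) ≡ (suc n ℕ.+ suc n) C n
    symmetric = trans (nCk≡nC[n∸k] (s≤s (ℕ.m≤n+m (suc n) n)))
                      (cong ((suc n ℕ.+ suc n) C_) (ℕ.m+n∸n≡m n (suc n)))

  -- Modulo p = 2m + 1

  ¬2∣n⇒n≡1+2m : ∀ {n} → ¬ 2 ∣ n → ∃[ m ] n ≡ suc (m ℕ.+ m)
  ¬2∣n⇒n≡1+2m {zero}        2∤n = contradiction (2 ∣0) 2∤n
  ¬2∣n⇒n≡1+2m {suc zero}    2∤n = 0 , refl
  ¬2∣n⇒n≡1+2m {suc (suc n)} 2∤n with ¬2∣n⇒n≡1+2m {n} (λ 2∣n → 2∤n (∣m∣n⇒∣m+n ∣-refl 2∣n))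
  ... | m , refl = suc m , cong (λ k → suc (suc k)) (sym (ℕ.+-suc m m))

  -4ℤ : ℤ
  -4ℤ = - (+ 4)

  module _ (m : ℕ) (prime : Prime (suc (m ℕ.+ m))) where

    private
      N p : ℕ
      N = m ℕ.+ m
      p = suc N

      +p≡1+m+m : + p ≡ 1ℤ + (+ m + + m)
      +p≡1+m+m = trans (ℤ.pos-+ 1 N) (cong (_+_ 1ℤ) (ℤ.pos-+ m m))

      -- The ring solver treats + 2 and -4ℤ as atoms, hence their unary spelling below.
      2[2a+1]≡-4[m-a] : ∀ a → + 2 * + suc (a ℕ.+ a) ≡ -4ℤ * (+ m - + a) mod p
      2[2a+1]≡-4[m-a] a = from∣ (Signed.divides (+ 2) (begin
        + 2 * + suc (a ℕ.+ a) - -4ℤ * (+ m - + a)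
          ≡⟨ cong (λ u → + 2 * u - -4ℤ * (+ m - + a)) (trans (ℤ.pos-+ 1 (a ℕ.+ a)) (cong (_+_ 1ℤ) (ℤ.pos-+ a a))) ⟩
        (1ℤ + 1ℤ) * (1ℤ + (+ a + + a)) - - (1ℤ + 1ℤ + 1ℤ + 1ℤ) * (+ m - + a)
          ≡⟨ rearrange (+ a) (+ m) ⟩
        (1ℤ + 1ℤ) * (1ℤ + (+ m + + m))
          ≡⟨ cong (+ 2 *_) +p≡1+m+m ⟨
        + 2 * + p ∎))
        where
        open ≡-Reasoning
        rearrange : ∀ a m → (1ℤ + 1ℤ) * (1ℤ + (a + a)) - - (1ℤ + 1ℤ + 1ℤ + 1ℤ) * (m - a) ≡ (1ℤ + 1ℤ) * (1ℤ + (m + m))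
        rearrange = solve-∀

      1≡2[m+1] : 1ℤ ≡ + 2 * + suc m mod p
      1≡2[m+1] = from∣ (Signed.divides -1ℤ (begin
        1ℤ - + 2 * + suc m
          ≡⟨ cong (λ u → 1ℤ - + 2 * u) (ℤ.pos-+ 1 m) ⟩
        1ℤ - (1ℤ + 1ℤ) * (1ℤ + + m)
          ≡⟨ rearrange (+ m) ⟩
        -1ℤ * (1ℤ + (+ m + + m))
          ≡⟨ cong (-1ℤ *_) +p≡1+m+m ⟨
        -1ℤ * + p ∎))
        where
        open ≡-Reasoning
        rearrange : ∀ m → 1ℤ - (1ℤ + 1ℤ) * (1ℤ + m) ≡ -1ℤ * (1ℤ + (m + m))
        rearrange = solve-∀

    central≡-mod : ∀ a → a ≤ N → central a ≡ -4ℤ ^ a * choose m a mod p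
    central≡-mod zero    _   = mod-refl
    central≡-mod (suc a) a<N = cancel-mod prime (+ suc a) (0<k<p⇒p∤k prime (s≤s z≤n) (s≤s a<N)) (begin
      + suc a * central (suc a)
        ≡⟨ [a+1]*central[a+1]≡2[2a+1]*central a ⟩
      + 2 * + suc (a ℕ.+ a) * central a
        ≈⟨ *-cong-mod (2[2a+1]≡-4[m-a] a) (central≡-mod a (ℕ.<⇒≤ a<N)) ⟩
      -4ℤ * (+ m - + a) * (-4ℤ ^ a * choose m a)
        ≡⟨ regroup -4ℤ (+ m - + a) (-4ℤ ^ a) (choose m a) ⟩
      -4ℤ ^ suc a * ((+ m - + a) * choose m a)
        ≡⟨ cong (-4ℤ ^ suc a *_) ([k+1]*nC[k+1]≡[n-k]*nCk m a) ⟨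
      -4ℤ ^ suc a * (+ suc a * choose m (suc a))
        ≡⟨ x*[y*z]≡y*[x*z] (-4ℤ ^ suc a) (+ suc a) (choose m (suc a)) ⟩
      + suc a * (-4ℤ ^ suc a * choose m (suc a)) ∎)
      where
      open mod-Reasoning p
      regroup : ∀ q d e c → q * d * (e * c) ≡ q * e * (d * c)
      regroup = solve-∀
      x*[y*z]≡y*[x*z] : ∀ x y z → x * (y * z) ≡ y * (x * z)
      x*[y*z]≡y*[x*z] = solve-∀

    catalan≡-mod : ∀ b → b < N → catalan b ≡ + 2 * -4ℤ ^ b * choose (suc m) (suc b) mod p
    catalan≡-mod b b<N = cancel-mod prime (+ suc b) (0<k<p⇒p∤k prime (s≤s z≤n) (s≤s b<N)) (begin
      + suc b * catalan b
        ≡⟨ [b+1]*catalan≡central b ⟩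
      central b
        ≈⟨ central≡-mod b (ℕ.<⇒≤ b<N) ⟩
      -4ℤ ^ b * choose m b
        ≡⟨ ℤ.*-identityˡ _ ⟨
      1ℤ * (-4ℤ ^ b * choose m b)
        ≈⟨ *-cong-mod 1≡2[m+1] mod-refl ⟩
      + 2 * + suc m * (-4ℤ ^ b * choose m b)
        ≡⟨ regroup (+ 2) (+ suc m) (-4ℤ ^ b) (choose m b) ⟩
      + 2 * -4ℤ ^ b * (+ suc m * choose m b)
        ≡⟨ cong (+ 2 * -4ℤ ^ b *_) ([k+1]*[n+1]C[k+1]≡[n+1]*nCk m b) ⟨
      + 2 * -4ℤ ^ b * (+ suc b * choose (suc m) (suc b))
        ≡⟨ x*[y*z]≡y*[x*z] (+ 2 * -4ℤ ^ b) (+ suc b) (choose (suc m) (suc b)) ⟩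
      + suc b * (+ 2 * -4ℤ ^ b * choose (suc m) (suc b)) ∎)
      where
      open mod-Reasoning p
      regroup : ∀ t s e c → t * s * (e * c) ≡ t * e * (s * c)
      regroup = solve-∀
      x*[y*z]≡y*[x*z] : ∀ x y z → x * (y * z) ≡ y * (x * z)
      x*[y*z]≡y*[x*z] = solve-∀

  -- D and S as integer sums

  B : ℕ → ℕ → ℤ
  B a k = choose (k ℕ.+ a) (a ℕ.+ a)

  B-vanish : ∀ {a k} → k < a → B a k ≡ 0ℤ
  B-vanish {a} k<a = k>n⇒choose≡0 (ℕ.+-monoˡ-< a k<a)

  Dℤ Sℤ : ℤ → ℕ → ℕ → ℤ
  Dℤ x M k = sum M (λ a → central a * x ^ a * B a k)
  Sℤ x M k = sum M (λ b → catalan b * x ^ b * B b k)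

  sum[B*B[N]]≡B : ∀ a N → sum (suc N) (λ k → B a k * B N k) ≡ B a N
  sum[B*B[N]]≡B a N = begin
    sum (suc N) (λ k → B a k * B N k)
      ≡⟨ sum-last N (λ k → B a k * B N k) ⟩
    sum N (λ k → B a k * B N k) + B a N * B N N
      ≡⟨ cong₂ _+_ (sum-zero N _ (λ k k<N → trans (cong (B a k *_) (B-vanish k<N)) (ℤ.*-zeroʳ (B a k))))
                   (trans (cong (B a N *_) (choose-n-n (N ℕ.+ N))) (ℤ.*-identityʳ (B a N))) ⟩
    0ℤ + B a N
      ≡⟨ ℤ.+-identityˡ (B a N) ⟩
    B a N ∎
    where open ≡-Reasoning

  Dℤ[0]≡1 : ∀ x M → Dℤ x (suc M) 0 ≡ 1ℤ
  Dℤ[0]≡1 x M = cong (_+_ 1ℤ) (sum-zero M _ (λ a _ → trans (cong (central (suc a) * x ^ suc a *_) (B-vanish {suc a} (s≤s z≤n)))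
                                                              (ℤ.*-zeroʳ (central (suc a) * x ^ suc a))))

  Sℤ[0]≡1 : ∀ x M → Sℤ x (suc M) 0 ≡ 1ℤ
  Sℤ[0]≡1 x M = cong (_+_ 1ℤ) (sum-zero M _ (λ a _ → trans (cong (catalan (suc a) * x ^ suc a *_) (B-vanish {suc a} (s≤s z≤n)))
                                                              (ℤ.*-zeroʳ (catalan (suc a) * x ^ suc a))))

  ℤ→ℚ≡mkℚ : ∀ z → ℤ→ℚ z ≡ mkℚ z 0 (Coprime.sym (1-coprimeTo ∣ z ∣))
  ℤ→ℚ≡mkℚ (+ n)    = ℚ.normalize-coprime (Coprime.sym (1-coprimeTo n))
  ℤ→ℚ≡mkℚ -[1+ n ] = cong ℚ.-_ (ℚ.normalize-coprime (Coprime.sym (1-coprimeTo (suc n))))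

  ℤ→ℚ-+ : ∀ a b → ℤ→ℚ (a + b) ≡ ℤ→ℚ a ℚ.+ ℤ→ℚ b
  ℤ→ℚ-+ a b = sym (trans (cong₂ ℚ._+_ (ℤ→ℚ≡mkℚ a) (ℤ→ℚ≡mkℚ b))
                         (cong ℤ→ℚ (cong₂ _+_ (ℤ.*-identityʳ a) (ℤ.*-identityʳ b))))

  ℤ→ℚ-* : ∀ a b → ℤ→ℚ (a * b) ≡ ℤ→ℚ a ℚ.* ℤ→ℚ b
  ℤ→ℚ-* a b = sym (cong₂ ℚ._*_ (ℤ→ℚ≡mkℚ a) (ℤ→ℚ≡mkℚ b))

  ↧ₙ-ℤ→ℚ : ∀ z → ↧ₙ (ℤ→ℚ z) ≡ 1
  ↧ₙ-ℤ→ℚ z = cong ↧ₙ_ (ℤ→ℚ≡mkℚ z)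

  ℤ→ℚ[n]*1/n≡1 : ∀ n → ℤ→ℚ (+ suc n) ℚ.* (+ 1 / suc n) ≡ 1ℚ
  ℤ→ℚ[n]*1/n≡1 n = trans (cong₂ ℚ._*_ (ℤ→ℚ≡mkℚ (+ suc n)) (ℚ.normalize-coprime (1-coprimeTo (suc n))))
                          (ℚ.*-inverseʳ (mkℚ (+ suc n) 0 (Coprime.sym (1-coprimeTo (suc n)))))

  Σ0to≡ℤ→ℚ-sum : ∀ n (h : ℕ → ℚ) (f : ℕ → ℤ) → (∀ j → j ≤ n → h j ≡ ℤ→ℚ (f j)) →
                 Σ0to n h ≡ ℤ→ℚ (sum (suc n) f)
  Σ0to≡ℤ→ℚ-sum zero    h f h≡f = trans (h≡f 0 z≤n) (cong ℤ→ℚ (sym (ℤ.+-identityʳ (f 0))))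
  Σ0to≡ℤ→ℚ-sum (suc n) h f h≡f = begin
    Σ0to n h ℚ.+ h (suc n)
      ≡⟨ cong₂ ℚ._+_ (Σ0to≡ℤ→ℚ-sum n h f (λ j j≤n → h≡f j (ℕ.m≤n⇒m≤1+n j≤n))) (h≡f (suc n) ℕ.≤-refl) ⟩
    ℤ→ℚ (sum (suc n) f) ℚ.+ ℤ→ℚ (f (suc n))
      ≡⟨ ℤ→ℚ-+ (sum (suc n) f) (f (suc n)) ⟨
    ℤ→ℚ (sum (suc n) f + f (suc n))
      ≡⟨ cong ℤ→ℚ (sum-last (suc n) f) ⟨
    ℤ→ℚ (sum (suc (suc n)) f) ∎
    where open ≡-Reasoning

  term≡central*B : ∀ x k j → term x k j ≡ central j * x ^ j * B j k
  term≡central*B x k j = begin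
    + ((k C j) ℕ.* ((k ℕ.+ j) C j)) * x ^ j
      ≡⟨ cong (_* x ^ j) (ℤ.pos-* (k C j) ((k ℕ.+ j) C j)) ⟩
    choose k j * choose (k ℕ.+ j) j * x ^ j
      ≡⟨ cong (_* x ^ j) (nCa*[n+a]Ca≡central*[n+a]C[2a] k j) ⟩
    central j * B j k * x ^ j
      ≡⟨ swap (central j) (B j k) (x ^ j) ⟩
    central j * x ^ j * B j k ∎
    where
    open ≡-Reasoning
    swap : ∀ c b y → c * b * y ≡ c * y * b
    swap = solve-∀

  term/[j+1]≡catalan*B : ∀ x k j → ℤ→ℚ (term x k j) ℚ.* (+ 1 / suc j) ≡ ℤ→ℚ (catalan j * x ^ j * B j k)
  term/[j+1]≡catalan*B x k j = begin
    ℤ→ℚ (term x k j) ℚ.* r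
      ≡⟨ cong (λ t → ℤ→ℚ t ℚ.* r) (term≡central*B x k j) ⟩
    ℤ→ℚ (central j * x ^ j * B j k) ℚ.* r
      ≡⟨ cong (λ c → ℤ→ℚ (c * x ^ j * B j k) ℚ.* r) ([b+1]*catalan≡central j) ⟨
    ℤ→ℚ (+ suc j * catalan j * x ^ j * B j k) ℚ.* r
      ≡⟨ cong (λ t → ℤ→ℚ t ℚ.* r) (regroup (+ suc j) (catalan j) (x ^ j) (B j k)) ⟩
    ℤ→ℚ (+ suc j * W) ℚ.* r
      ≡⟨ cong (ℚ._* r) (trans (ℤ→ℚ-* (+ suc j) W) (ℚ.*-comm (ℤ→ℚ (+ suc j)) (ℤ→ℚ W))) ⟩
    ℤ→ℚ W ℚ.* ℤ→ℚ (+ suc j) ℚ.* r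
      ≡⟨ ℚ.*-assoc (ℤ→ℚ W) (ℤ→ℚ (+ suc j)) r ⟩
    ℤ→ℚ W ℚ.* (ℤ→ℚ (+ suc j) ℚ.* r)
      ≡⟨ cong (ℤ→ℚ W ℚ.*_) (ℤ→ℚ[n]*1/n≡1 j) ⟩
    ℤ→ℚ W ℚ.* 1ℚ
      ≡⟨ ℚ.*-identityʳ (ℤ→ℚ W) ⟩
    ℤ→ℚ W ∎
    where
    open ≡-Reasoning
    r : ℚ
    r = + 1 / suc j
    W : ℤ
    W = catalan j * x ^ j * B j k
    regroup : ∀ s c y b → s * c * y * b ≡ s * (c * y * b)
    regroup = solve-∀

  D≡Dℤ : ∀ x M k → k < M → D k x ≡ ℤ→ℚ (Dℤ x M k)
  D≡Dℤ x M k k<M =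
    trans (Σ0to≡ℤ→ℚ-sum k _ (λ j → central j * x ^ j * B j k) (λ j _ → cong ℤ→ℚ (term≡central*B x k j)))
          (cong ℤ→ℚ (sum-extend _ vanish k<M))
    where
    vanish : ∀ j → suc k ≤ j → central j * x ^ j * B j k ≡ 0ℤ
    vanish j k<j = trans (cong (central j * x ^ j *_) (B-vanish k<j)) (ℤ.*-zeroʳ (central j * x ^ j))

  S≡Sℤ : ∀ x M k → k < M → S k x ≡ ℤ→ℚ (Sℤ x M k)
  S≡Sℤ x M k k<M =
    trans (Σ0to≡ℤ→ℚ-sum k _ (λ j → catalan j * x ^ j * B j k) (λ j _ → term/[j+1]≡catalan*B x k j))
          (cong ℤ→ℚ (sum-extend _ vanish k<M))
    where
    vanish : ∀ j → suc k ≤ j → catalan j * x ^ j * B j k ≡ 0ℤ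
    vanish j k<j = trans (cong (catalan j * x ^ j *_) (B-vanish k<j)) (ℤ.*-zeroʳ (catalan j * x ^ j))

  Σ1to-D*S≡ℤ→ℚ : ∀ x M n → n < M →
    Σ1to n (λ k → D k x ℚ.* S k x) ≡ ℤ→ℚ (sum n (λ k → Dℤ x M (suc k) * Sℤ x M (suc k)))
  Σ1to-D*S≡ℤ→ℚ x M zero    _   = refl
  Σ1to-D*S≡ℤ→ℚ x M (suc n) n<M = begin
    Σ1to n (λ k → D k x ℚ.* S k x) ℚ.+ D (suc n) x ℚ.* S (suc n) x
      ≡⟨ cong₂ ℚ._+_ (Σ1to-D*S≡ℤ→ℚ x M n (ℕ.<-trans (ℕ.n<1+n n) n<M))
                     (cong₂ ℚ._*_ (D≡Dℤ x M (suc n) n<M) (S≡Sℤ x M (suc n) n<M)) ⟩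
    ℤ→ℚ T ℚ.+ ℤ→ℚ (Dℤ x M (suc n)) ℚ.* ℤ→ℚ (Sℤ x M (suc n))
      ≡⟨ cong (ℤ→ℚ T ℚ.+_) (ℤ→ℚ-* (Dℤ x M (suc n)) (Sℤ x M (suc n))) ⟨
    ℤ→ℚ T ℚ.+ ℤ→ℚ (Dℤ x M (suc n) * Sℤ x M (suc n))
      ≡⟨ ℤ→ℚ-+ T _ ⟨
    ℤ→ℚ (T + Dℤ x M (suc n) * Sℤ x M (suc n))
      ≡⟨ cong ℤ→ℚ (sum-last n (λ k → Dℤ x M (suc k) * Sℤ x M (suc k))) ⟨
    ℤ→ℚ (sum (suc n) (λ k → Dℤ x M (suc k) * Sℤ x M (suc k))) ∎
    where
    open ≡-Reasoning
    T : ℤ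
    T = sum n (λ k → Dℤ x M (suc k) * Sℤ x M (suc k))

  integral≡0-mod : ∀ {p r t} → 1 < p → r ≡ ℤ→ℚ t → t ≡ 0ℤ mod p → r ≡ 0ℚ [mod p ^ 1 ]
  integral≡0-mod {p} {t = t} p>1 refl (from∣ (Signed.divides q t-0≡q*p)) = ℤ→ℚ q , t≡p*q , p∤1
    where
    open ≡-Reasoning
    t≡p*q : ℤ→ℚ t ℚ.- 0ℚ ≡ ℤ→ℚ (+ (p ℕ.^ 1)) ℚ.* ℤ→ℚ q
    t≡p*q = begin
      ℤ→ℚ t ℚ.- 0ℚ                   ≡⟨ ℚ.+-identityʳ (ℤ→ℚ t) ⟩
      ℤ→ℚ t                          ≡⟨ cong ℤ→ℚ (trans (sym (ℤ.+-identityʳ t)) t-0≡q*p) ⟩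
      ℤ→ℚ (q * + p)                  ≡⟨ cong ℤ→ℚ (ℤ.*-comm q (+ p)) ⟩
      ℤ→ℚ (+ p * q)                  ≡⟨ ℤ→ℚ-* (+ p) q ⟩
      ℤ→ℚ (+ p) ℚ.* ℤ→ℚ q            ≡⟨ cong (λ n → ℤ→ℚ (+ n) ℚ.* ℤ→ℚ q) (ℕ.*-identityʳ p) ⟨
      ℤ→ℚ (+ (p ℕ.^ 1)) ℚ.* ℤ→ℚ q    ∎
    p∤1 : ¬ p ∣ ↧ₙ ℤ→ℚ q
    p∤1 p∣1 = ℕ.<-irrefl (sym (∣1⇒≡1 (subst (p ∣_) (↧ₙ-ℤ→ℚ q) p∣1))) p>1

  module _ (m′ : ℕ) (prime : Prime (suc (suc m′ ℕ.+ suc m′))) (x : ℤ) where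

    private
      m N p : ℕ
      m = suc m′
      N = m ℕ.+ m
      p = suc N

      H : ℕ → ℕ → ℤ
      H a b = sum p (λ k → B a k * B b k)

      G : ℕ → ℤ
      G s = choose (suc (N ℕ.+ s)) (suc (s ℕ.+ s))

      F : ℕ → ℤ
      F s = + 2 * (-4ℤ * x) ^ s * G s

      coeff : ℕ → ℕ → ℤ
      coeff a b = choose m a * choose (suc m) (suc b)

      γ : ℕ → ℕ → ℤ
      γ a b = central a * x ^ a * (catalan b * x ^ b) * H a b

      coeff≡0 : ∀ {a b} → ¬ (a ≤ m × b ≤ m) → coeff a b ≡ 0ℤ
      coeff≡0 {a} {b} ¬a,b≤m with a ℕ.≤? m | b ℕ.≤? m
      ... | yes a≤m | yes b≤m = contradiction (a≤m , b≤m) ¬a,b≤m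
      ... | no  a≰m | _       = cong (_* choose (suc m) (suc b)) (k>n⇒choose≡0 (ℕ.≰⇒> a≰m))
      ... | yes _   | no b≰m  = trans (cong (choose m a *_) (k>n⇒choose≡0 (s≤s (ℕ.≰⇒> b≰m)))) (ℤ.*-zeroʳ (choose m a))

    H≡G-mod : ∀ {a b} → a ≤ m → b ≤ m → H a b ≡ G (a ℕ.+ b) mod p
    H≡G-mod {a} {b} a≤m b≤m = begin
      sum p (λ k → B a k * B b k)
        ≈⟨ sum-cong-mod p (λ k k<p → *-cong-mod (mod-refl {a = B a k}) (reflect k (ℕ.≤-pred k<p))) ⟩
      sum p (λ k → B a k * B b (N ∸ k))
        ≡⟨ antidiagonal≡sum N (λ k j → B a k * B b j) ⟨
      (B a ⋆ B b) N
        ≡⟨ shifted-choose-⋆-choose a b N ⟩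
      G (a ℕ.+ b) ∎
      where
      open mod-Reasoning p
      reflect : ∀ k → k ≤ N → B b k ≡ B b (N ∸ k) mod p
      reflect k k≤N = choose-reflect-mod prime {k} {N ∸ k} b (cong suc (ℕ.m+[n∸m]≡n k≤N)) (s≤s (ℕ.+-mono-≤ b≤m b≤m))

    coeff*H≡coeff*G-mod : ∀ a b y → coeff a b * y * H a b ≡ coeff a b * y * G (a ℕ.+ b) mod p
    coeff*H≡coeff*G-mod a b y with a ℕ.≤? m ×-dec b ℕ.≤? m
    ... | yes (a≤m , b≤m) = *-cong-mod (mod-refl {a = coeff a b * y}) (H≡G-mod a≤m b≤m)
    ... | no ¬a,b≤m       = ≡⇒≡mod (trans (cong (λ c → c * y * H a b) (coeff≡0 ¬a,b≤m))
                                          (sym (cong (λ c → c * y * G (a ℕ.+ b)) (coeff≡0 ¬a,b≤m))))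

    γ≡coeff*F-mod : ∀ {a b} → a < p → b < N → γ a b ≡ coeff a b * F (a ℕ.+ b) mod p
    γ≡coeff*F-mod {a} {b} a<p b<N = begin
      central a * x ^ a * (catalan b * x ^ b) * H a b
        ≈⟨ *-cong-mod (*-cong-mod (*-cong-mod (central≡-mod m prime a (ℕ.≤-pred a<p)) mod-refl)
                                  (*-cong-mod (catalan≡-mod m prime b b<N) mod-refl)) mod-refl ⟩
      -4ℤ ^ a * choose m a * x ^ a * (+ 2 * -4ℤ ^ b * choose (suc m) (suc b) * x ^ b) * H a b
        ≡⟨ regroup (+ 2) (-4ℤ ^ a) (choose m a) (x ^ a) (-4ℤ ^ b) (choose (suc m) (suc b)) (x ^ b) (H a b) ⟩
      coeff a b * (+ 2 * (-4ℤ ^ a * x ^ a * (-4ℤ ^ b * x ^ b))) * H a b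
        ≡⟨ cong (λ y → coeff a b * (+ 2 * y) * H a b) power ⟨
      coeff a b * (+ 2 * (-4ℤ * x) ^ (a ℕ.+ b)) * H a b
        ≈⟨ coeff*H≡coeff*G-mod a b (+ 2 * (-4ℤ * x) ^ (a ℕ.+ b)) ⟩
      coeff a b * (+ 2 * (-4ℤ * x) ^ (a ℕ.+ b)) * G (a ℕ.+ b)
        ≡⟨ ℤ.*-assoc (coeff a b) _ (G (a ℕ.+ b)) ⟩
      coeff a b * F (a ℕ.+ b) ∎
      where
      open mod-Reasoning p
      regroup : ∀ two qa ca xa qb cb xb h →
                qa * ca * xa * (two * qb * cb * xb) * h ≡ ca * cb * (two * (qa * xa * (qb * xb))) * h
      regroup = solve-∀
      power : (-4ℤ * x) ^ (a ℕ.+ b) ≡ -4ℤ ^ a * x ^ a * (-4ℤ ^ b * x ^ b)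
      power = trans (ℤ.^-distribˡ-+-* (-4ℤ * x) a b) (cong₂ _*_ (^-distribʳ-* -4ℤ x a) (^-distribʳ-* -4ℤ x b))

    private
      coeff*F≡0 : ∀ a b → ¬ (a ≤ m × b ≤ m) → coeff a b * F (a ℕ.+ b) ≡ 0ℤ
      coeff*F≡0 a b ¬a,b≤m = cong (_* F (a ℕ.+ b)) (coeff≡0 ¬a,b≤m)

      m<N : m < N
      m<N = ℕ.m<m+n m (s≤s z≤n)

      [p[1+s]-m[1+s]]*F≡0-mod : ∀ {s} → s < N → (choose p (suc s) - choose m (suc s)) * F s ≡ 0ℤ mod p
      [p[1+s]-m[1+s]]*F≡0-mod {s} s<N with s ℕ.<? m
      ... | yes s<m = mod-trans (*-cong-mod (mod-refl {a = c}) (*-cong-mod (mod-refl {a = + 2 * (-4ℤ * x) ^ s}) G≡0))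
                                (≡⇒≡mod (trans (cong (c *_) (ℤ.*-zeroʳ (+ 2 * (-4ℤ * x) ^ s))) (ℤ.*-zeroʳ c)))
        where
        c : ℤ
        c = choose p (suc s) - choose m (suc s)
        G≡0 : G s ≡ 0ℤ mod p
        G≡0 = mod-trans (≡⇒≡mod (cong (λ n → choose n (suc (s ℕ.+ s))) (ℕ.+-comm p s)))
                        (mod-trans (choose[n+p]≡choose-mod prime s (s≤s (ℕ.+-mono-< s<m s<m)))
                                   (≡⇒≡mod (k>n⇒choose≡0 (s≤s (ℕ.m≤m+n s s)))))
      ... | no s≮m = *-cong-mod (+-cong-mod (choose[n+p]≡choose-mod prime 0 (s≤s s<N))
                                             (≡⇒≡mod (cong -_ (k>n⇒choose≡0 (s≤s (ℕ.≮⇒≥ s≮m))))))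
                                (mod-refl {a = F s})

    sum[γ[<N]]≡2[-4x]^N-mod : sum p (λ a → sum N (γ a)) ≡ + 2 * (-4ℤ * x) ^ N mod p
    sum[γ[<N]]≡2[-4x]^N-mod = begin
      sum p (λ a → sum N (γ a))
        ≈⟨ sum-cong-mod p (λ a a<p → sum-cong-mod N (λ b b<N → γ≡coeff*F-mod a<p b<N)) ⟩
      sum p (λ a → sum N (τ a))
        ≡⟨ sum-cong p (λ a _ → sum-extend (τ a) (λ b N≤b → coeff*F≡0 a b (λ (_ , b≤m) → ℕ.<-irrefl refl
                                                     (ℕ.<-≤-trans m<N (ℕ.≤-trans N≤b b≤m))))
                                            (ℕ.n≤1+n N)) ⟩
      sum p (λ a → sum p (τ a))
        ≡⟨ sum-square≡sum-antidiagonal p τ (λ a b p≤a+b → coeff*F≡0 a b (λ (a≤m , b≤m) →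
                                             ℕ.<⇒≱ (s≤s (ℕ.+-mono-≤ a≤m b≤m)) p≤a+b)) ⟩
      sum p (antidiagonal τ)
        ≡⟨ sum-cong p (λ s _ → trans (antidiagonal-*ʳ s coeff F) (cong (_* F s) (vandermonde′ s))) ⟩
      sum p (λ s → (choose p (suc s) - choose m (suc s)) * F s)
        ≡⟨ sum-last N (λ s → (choose p (suc s) - choose m (suc s)) * F s) ⟩
      sum N (λ s → (choose p (suc s) - choose m (suc s)) * F s) + (choose p p - choose m p) * F N
        ≈⟨ +-cong-mod (sum≡0-mod N _ (λ s s<N → [p[1+s]-m[1+s]]*F≡0-mod s<N)) mod-refl ⟩
      0ℤ + (choose p p - choose m p) * (+ 2 * (-4ℤ * x) ^ N * G N)
        ≡⟨ cong₂ (λ u v → 0ℤ + (u - v) * (+ 2 * (-4ℤ * x) ^ N * G N))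
                 (choose-n-n p) (k>n⇒choose≡0 (ℕ.<-trans m<N (ℕ.n<1+n N))) ⟩
      0ℤ + (1ℤ - 0ℤ) * (+ 2 * (-4ℤ * x) ^ N * G N)
        ≡⟨ cong (λ g → 0ℤ + (1ℤ - 0ℤ) * (+ 2 * (-4ℤ * x) ^ N * g)) (choose-n-n (suc (N ℕ.+ N))) ⟩
      0ℤ + (1ℤ - 0ℤ) * (+ 2 * (-4ℤ * x) ^ N * 1ℤ)
        ≡⟨ simplify (+ 2 * (-4ℤ * x) ^ N) ⟩
      + 2 * (-4ℤ * x) ^ N ∎
      where
      open mod-Reasoning p
      τ : ℕ → ℕ → ℤ
      τ a b = coeff a b * F (a ℕ.+ b)
      vandermonde′ : ∀ s → (choose m ⋆ (λ b → choose (suc m) (suc b))) s ≡ choose p (suc s) - choose m (suc s)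
      vandermonde′ s = trans (choose-⋆-choose∘suc m (suc m) s)
                             (cong (λ n → choose n (suc s) - choose m (suc s)) (ℕ.+-suc m m))
      simplify : ∀ y → 0ℤ + (1ℤ - 0ℤ) * (y * 1ℤ) ≡ y
      simplify = solve-∀

    γ[1+a,N]≡0-mod : ∀ {a} → a < N → γ (suc a) N ≡ 0ℤ mod p
    γ[1+a,N]≡0-mod {a} a<N with suc a ℕ.≤? m
    ... | yes 1+a≤m = begin
      γ (suc a) N
        ≡⟨ cong (c *_) (sum[B*B[N]]≡B (suc a) N) ⟩
      c * choose (N ℕ.+ suc a) (suc a ℕ.+ suc a)
        ≡⟨ cong (λ n → c * choose n (suc a ℕ.+ suc a)) (reorder N a) ⟩
      c * choose (a ℕ.+ p) (suc a ℕ.+ suc a)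
        ≈⟨ *-cong-mod (mod-refl {a = c}) (choose[n+p]≡choose-mod prime a (s≤s (ℕ.+-mono-≤ 1+a≤m 1+a≤m))) ⟩
      c * choose a (suc a ℕ.+ suc a)
        ≡⟨ cong (c *_) (k>n⇒choose≡0 (s≤s (ℕ.≤-trans (ℕ.n≤1+n a) (ℕ.m≤n+m (suc a) a)))) ⟩
      c * 0ℤ
        ≡⟨ ℤ.*-zeroʳ c ⟩
      0ℤ ∎
      where
      open mod-Reasoning p
      c : ℤ
      c = central (suc a) * x ^ suc a * (catalan N * x ^ N)
      reorder : ∀ N a → N ℕ.+ suc a ≡ a ℕ.+ suc N
      reorder = solve-∀ℕ
    ... | no 1+a≰m = begin
      central (suc a) * x ^ suc a * (catalan N * x ^ N) * H (suc a) N
        ≈⟨ *-cong-mod (*-cong-mod (*-cong-mod (central≡-mod m prime (suc a) a<N) mod-refl) mod-refl) mod-refl ⟩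
      -4ℤ ^ suc a * choose m (suc a) * x ^ suc a * (catalan N * x ^ N) * H (suc a) N
        ≡⟨ cong (λ c → -4ℤ ^ suc a * c * x ^ suc a * (catalan N * x ^ N) * H (suc a) N) (k>n⇒choose≡0 (ℕ.≰⇒> 1+a≰m)) ⟩
      -4ℤ ^ suc a * 0ℤ * x ^ suc a * (catalan N * x ^ N) * H (suc a) N
        ≡⟨ annihilate (-4ℤ ^ suc a) (x ^ suc a) (catalan N * x ^ N) (H (suc a) N) ⟩
      0ℤ ∎
      where
      open mod-Reasoning p
      annihilate : ∀ q y c h → q * 0ℤ * y * c * h ≡ 0ℤ
      annihilate = solve-∀

    sum[γ[·,N]]≡-x^N-mod : sum p (λ a → γ a N) ≡ -1ℤ * x ^ N mod p
    sum[γ[·,N]]≡-x^N-mod = begin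
      γ 0 N + sum N (λ a → γ (suc a) N)
        ≈⟨ +-cong-mod (mod-refl {a = γ 0 N}) (sum≡0-mod N _ (λ a a<N → γ[1+a,N]≡0-mod a<N)) ⟩
      γ 0 N + 0ℤ
        ≡⟨ cong (λ h → 1ℤ * 1ℤ * (catalan N * x ^ N) * h + 0ℤ) (sum[B*B[N]]≡B 0 N) ⟩
      1ℤ * 1ℤ * (catalan N * x ^ N) * 1ℤ + 0ℤ
        ≡⟨ simplify (catalan N * x ^ N) ⟩
      catalan N * x ^ N
        ≈⟨ *-cong-mod (catalan[p-1]≡-1 (m′ ℕ.+ m) prime) mod-refl ⟩
      -1ℤ * x ^ N ∎
      where
      open mod-Reasoning p
      simplify : ∀ y → 1ℤ * 1ℤ * y * 1ℤ + 0ℤ ≡ y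
      simplify = solve-∀

    sum[D*S]≡0-mod : ¬ p ∣ ∣ x ∣ → sum N (λ k → Dℤ x p (suc k) * Sℤ x p (suc k)) ≡ 0ℤ mod p
    sum[D*S]≡0-mod p∤x = begin
      T
        ≡⟨ shift T ⟩
      -1ℤ + (1ℤ * 1ℤ + T)
        ≡⟨ cong (λ u → -1ℤ + (u + T)) (cong₂ _*_ (Dℤ[0]≡1 x N) (Sℤ[0]≡1 x N)) ⟨
      -1ℤ + sum p (λ k → Dℤ x p k * Sℤ x p k)
        ≡⟨ cong (_+_ -1ℤ) (sum-bilinear p p (λ a → central a * x ^ a) (λ b → catalan b * x ^ b) B) ⟩
      -1ℤ + sum p (λ a → sum p (γ a))
        ≡⟨ cong (_+_ -1ℤ) (trans (sum-cong p (λ a _ → sum-last N (γ a))) (sum-+ p (λ a → sum N (γ a)) (λ a → γ a N))) ⟩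
      -1ℤ + (sum p (λ a → sum N (γ a)) + sum p (λ a → γ a N))
        ≈⟨ +-cong-mod (mod-refl {a = -1ℤ}) (+-cong-mod sum[γ[<N]]≡2[-4x]^N-mod sum[γ[·,N]]≡-x^N-mod) ⟩
      -1ℤ + (+ 2 * (-4ℤ * x) ^ N + -1ℤ * x ^ N)
        ≡⟨ cong (λ y → -1ℤ + (+ 2 * y + -1ℤ * x ^ N)) (^-distribʳ-* -4ℤ x N) ⟩
      -1ℤ + (+ 2 * (-4ℤ ^ N * x ^ N) + -1ℤ * x ^ N)
        ≈⟨ +-cong-mod (mod-refl {a = -1ℤ}) (+-cong-mod (*-cong-mod (mod-refl {a = + 2}) (*-cong-mod (fermat-little prime -4ℤ p∤4) x^N≡1))
                                                   (*-cong-mod (mod-refl {a = -1ℤ}) x^N≡1)) ⟩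
      -1ℤ + (+ 2 * (1ℤ * 1ℤ) + -1ℤ * 1ℤ)
        ≡⟨⟩
      0ℤ ∎
      where
      open mod-Reasoning p
      T : ℤ
      T = sum N (λ k → Dℤ x p (suc k) * Sℤ x p (suc k))
      shift : ∀ t → t ≡ -1ℤ + (1ℤ * 1ℤ + t)
      shift = solve-∀
      x^N≡1 : x ^ N ≡ 1ℤ mod p
      x^N≡1 = fermat-little prime x p∤x
      2<p : 2 < p
      2<p = s≤s (s≤s (ℕ.≤-trans (s≤s z≤n) (ℕ.m≤n+m m m′)))
      p∤2 : ¬ p ∣ 2
      p∤2 = 0<k<p⇒p∤k prime (s≤s z≤n) 2<p
      p∤4 : ¬ p ∣ 4
      p∤4 p∣4 = [ p∤2 , p∤2 ]′ (euclidsLemma 2 2 prime p∣4)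

open import Data.Nat using (ℕ; _∸_)
open import Data.Nat.Primality using (Prime)
open import Data.Nat.Divisibility using (_∣_)
open import Data.Integer using (ℤ; +_)
open import Data.Integer.Divisibility using () renaming (_∣_ to _∣ℤ_)
open import Data.Rational using (0ℚ; _*_)
open import Relation.Nullary using (¬_)

open import Data.Nat.Base using (zero; suc)
import Data.Nat.Properties as ℕ
open import Data.Nat.Primality using (¬prime[1])
open import Data.Product.Base using (_,_)
open import Relation.Binary.PropositionalEquality using (refl)
open import Relation.Nullary.Negation using (contradiction)

theorem1p2 : (p : ℕ) → Prime p → ¬ (2 ∣ p) → (x : ℤ) → ¬ ((+ p) ∣ℤ x) →
    Σ1to (p ∸ 1) (λ k → D k x * S k x) ≡ 0ℚ [mod p ^ 1 ]
theorem1p2 p p-prime 2∤p x p∤x with ¬2∣n⇒n≡1+2m 2∤p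
... | zero   , refl = contradiction p-prime ¬prime[1]
... | suc m′ , refl =
  integral≡0-mod (p>1 p-prime) (Σ1to-D*S≡ℤ→ℚ x p (p ∸ 1) ℕ.≤-refl) (sum[D*S]≡0-mod m′ p-prime x p∤x)
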